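{- Let $p$ be a prime, let $G=\mathbb{F}_p^r$, and let $G_1,\ldots,G_N$ (with $N=(p^r-1)/(p-1)$) be the subgroups of $G$ of index $p$. For a subgroup $H\subseteq G$ let $\epsilon_H=\frac{1}{|H|}\sum_{\sigma\in H}\sigma$. Let $M$ be a finite $G$-module whose order is prime to $p$, so that $\mathbb{Z}[p^{ -1}][G]$ acts on $M$. Then: (a) for every subgroup $H\subseteq G$, $\epsilon_HM=M^H$, the subgroup of elements of $M$ fixed by $H$; (b) the map \[ \frac{M}{M^G}\longrightarrow\bigoplus_{i=1}^N\frac{\epsilon_{G_i}M}{\epsilon_GM}=\bigoplus_{i=1}^N\frac{M^{G_i}}{M^G},\qquad m\mapsto(\epsilon_{G_1}m,\ldots,\epsilon_{G_N}m)\] is an isomorphism, whose inverse is the summation map $(m_1,\ldots,m_N)\mapsto m_1+\cdots+m_N$. -}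

module Defs where

open import Level using (Level; _⊔_) renaming (suc to lsuc)
open import Data.Nat using (ℕ; zero; suc; _+_; _*_; _∸_; _^_; NonZero)
open import Data.Nat.DivMod using (_mod_)
open import Data.Nat.Coprimality using (Coprime)
open import Data.Fin using (Fin; toℕ)
open import Data.Vec using (Vec; []; _∷_; zipWith; replicate)
open import Data.Vec.Functional using () renaming (foldr to foldrF)
open import Data.List using (List; []; _∷_; map; concatMap; allFin; filterᵇ; length; foldr)
open import Data.Bool using (Bool; true)
open import Data.Product using (_×_; ∃)
open import Relation.Binary.PropositionalEquality using (_≡_)
import Relation.Binary.PropositionalEquality as ≡
open import Algebra.Bundles using (AbelianGroup)
open import Function.Bundles using (Bijection)

module _ (p : ℕ) {{nz : NonZero p}} where

  G : ℕ → Set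
  G r = Vec (Fin p) r

  _+F_ : Fin p → Fin p → Fin p
  a +F b = (toℕ a + toℕ b) mod p

  -F_ : Fin p → Fin p
  -F a = (p ∸ toℕ a) mod p

  module _ (r : ℕ) where

    0G : G r
    0G = replicate r (0 mod p)

    _+G_ : G r → G r → G r
    _+G_ = zipWith _+F_

    -G_ : G r → G r
    -G_ = Data.Vec.map -F_

  allG : (r : ℕ) → List (G r)
  allG zero = [] ∷ []
  allG (suc r) = concatMap (λ a → map (a ∷_) (allG r)) (allFin p)

  module _ (r : ℕ) where

    Subset : Set
    Subset = G r → Bool

    _∈S_ : G r → Subset → Set
    g ∈S H = H g ≡ true

    IsSubgroup : Subset → Set
    IsSubgroup H = (0G r ∈S H)
                 × (∀ g h → g ∈S H → h ∈S H → (_+G_ r g h) ∈S H)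
                 × (∀ g → g ∈S H → (-G_ r g) ∈S H)

    elems : Subset → List (G r)
    elems H = filterᵇ H (allG r)

    card : Subset → ℕ
    card H = length (elems H)

    HasIndexP : Subset → Set
    HasIndexP H = p * card H ≡ p ^ r

    whole : Subset
    whole _ = true

    SameSubset : Subset → Subset → Set
    SameSubset H K = ∀ g → H g ≡ K g

    record GModule (c ℓ : Level) : Set (lsuc (c ⊔ ℓ)) where
      field
        grp : AbelianGroup c ℓ
      open AbelianGroup grp public
      field
        act      : G r → Carrier → Carrier
        act-cong : ∀ g {x y} → x ≈ y → act g x ≈ act g y
        act-0    : ∀ x → act (0G r) x ≈ x
        act-+    : ∀ g h x → act (_+G_ r g h) x ≈ act g (act h x)
        act-∙    : ∀ g x y → act g (x ∙ y) ≈ (act g x ∙ act g y)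

    module _ {c ℓ : Level} (M : GModule c ℓ) where
      open GModule M

      HasOrder : ℕ → Set (c ⊔ ℓ)
      HasOrder n = Bijection (≡.setoid (Fin n)) setoid

      times : ℕ → Carrier → Carrier
      times zero x = ε
      times (suc d) x = x ∙ times d x

      -- inv d is the action of 1/d (d invertible on M):
      -- a two-sided, congruent inverse of multiplication by d
      IsInverseOfMult : ℕ → (ℕ → Carrier → Carrier) → Set (c ⊔ ℓ)
      IsInverseOfMult n inv =
        ∀ d → Coprime d n →
          (∀ {x y} → x ≈ y → inv d x ≈ inv d y)
          × (∀ x → times d (inv d x) ≈ x)
          × (∀ x → inv d (times d x) ≈ x)

      sumList : List Carrier → Carrier
      sumList = foldr _∙_ ε

      sumFin : (N : ℕ) → (Fin N → Carrier) → Carrier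
      sumFin N f = foldrF _∙_ ε f

      epsH : (ℕ → Carrier → Carrier) → Subset → Carrier → Carrier
      epsH inv H m = inv (card H) (sumList (map (λ σ → act σ m) (elems H)))

      Fixed : Subset → Carrier → Set ℓ
      Fixed H x = ∀ σ → σ ∈S H → act σ x ≈ x

      _-M_ : Carrier → Carrier → Carrier
      x -M y = x ∙ (y ⁻¹)

{-# OPTIONS --safe #-}
module Submission where

-- Since |H| divides p^r it is invertible on M, and averaging over H is a projection of M onto M^H;
-- this is (a). For (b), identify the index-p subgroups of F_p^r with the hyperplanes ker a, one for
-- each nonzero a whose first nonzero coordinate is 1. That every index-p subgroup H is such a
-- hyperplane is a counting argument: if H lay in none of them, each H ∩ ker a would have at most
-- |H|/p elements, too few for the double count of the pairs (a, τ) with τ ∈ H ∩ ker a.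
-- A nonzero vector lies in exactly (p^(r-1) - 1)/(p - 1) of the N hyperplanes and 0 lies in all of
-- them, so ∑ᵢ |Gᵢ| ε_{Gᵢ} m = (p^(r-1) - 1)/(p - 1) · ∑_{σ ∈ G} σ m + p^(r-1) m, that is,
-- ∑ᵢ ε_{Gᵢ} m ≡ m modulo M^G. Conversely, for i ≠ j and m ∈ M^{Gᵢ} the element ε_{Gⱼ} m is fixed by
-- Gᵢ and Gⱼ; as Gⱼ is maximal its stabiliser is G, so ε_{Gⱼ} (m₁ + ⋯ + m_N) ≡ mⱼ modulo M^G.

open import Defs
open import Level using (Level; 0ℓ)
open import Algebra.Bundles using (CommutativeMonoid; AbelianGroup; CommutativeRing)
import Algebra.Properties.AbelianGroup as AbelianGroupProperties
import Algebra.Properties.CommutativeMonoid.Mult as CommutativeMonoidMult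
import Algebra.Properties.CommutativeSemigroup as CommutativeSemigroupProperties
import Algebra.Properties.Monoid.Mult as MonoidMult
import Algebra.Properties.Ring as RingProperties
open import Data.Bool using (Bool; true; false; _∧_; not; if_then_else_)
import Data.Bool as Bool
open import Data.Bool.Properties using (¬-not)
open import Data.Fin using (Fin; zero; suc; toℕ) renaming (_≟_ to _≟F_)
open import Data.Fin.Properties using (toℕ-fromℕ<; toℕ-injective; toℕ<n)
open import Data.List using (List; []; _∷_; _++_; map; concatMap; filterᵇ; length; allFin; tabulate; cartesianProductWith)
open import Data.List.Properties using (length-tabulate; length-++; length-map; map-tabulate)
open import Data.List.Membership.Propositional using (_∈_; find; lose)
open import Data.List.Membership.Propositional.Properties
  using (∈-map⁺; ∈-map⁻; ∈-++⁻; ∈-allFin; ∈-cartesianProductWith⁺)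
open import Data.List.Membership.Propositional.Properties.WithK using (unique∧set⇒bag)
open import Data.List.Relation.Binary.BagAndSetEquality using (∼bag⇒↭)
open import Data.List.Relation.Binary.Permutation.Propositional as ↭ using (_↭_)
import Data.List.Relation.Unary.All as All
open import Data.List.Relation.Unary.AllPairs using ([]; _∷_)
open import Data.List.Relation.Unary.Any using (here; there; any?)
open import Data.List.Relation.Unary.Unique.Propositional using (Unique)
import Data.List.Relation.Unary.Unique.Propositional.Properties as Unique
open import Data.Nat
  using ( ℕ; zero; suc; NonZero; _+_; _*_; _∸_; _^_; _%_; _≤_; _<_; z≤n; s≤s
        ; ≢-nonZero; >-nonZero; >-nonZero⁻¹; nonTrivial⇒n>1)
open import Data.Nat.Properties
  using ( +-0-commutativeMonoid; *-commutativeSemigroup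
        ; +-comm; +-assoc; +-identityʳ; *-comm; *-assoc; *-identityˡ; *-identityʳ; *-zeroʳ
        ; *-distribˡ-+; *-distribʳ-+; *-cancelˡ-≡; *-cancelˡ-≤; *-cancelˡ-<; 1+n≢0; m∸n+n≡m; n<1⇒n≡0; n≤0⇒n≡0
        ; ≤-refl; ≤-trans; ≤-reflexive; ≤-pred; <-≤-trans; <⇒≤; <⇒≱; m<m+n; m≤m+n; m≤n+m; m^n≢0; m^n>0
        ; +-mono-≤; +-mono-<-≤; +-mono-≤-<; +-monoʳ-≤; *-monoʳ-≤; *-monoʳ-<; module ≤-Reasoning)
open import Data.Nat.Coprimality using (Coprime; coprime-Bézout; coprime-divisor; prime⇒coprime)
import Data.Nat.Coprimality as Coprime
open import Data.Nat.DivMod using (_mod_; %-distribˡ-+; %-distribˡ-*; m<n⇒m%n≡m; n%n≡0; [m+kn]%n≡m%n; m*n%n≡0)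
open import Data.Nat.Divisibility
  using (_∣_; divides; _∣0; ∣-refl; ∣-trans; ∣⇒≤; ∣1⇒≡1; ∣m∣n⇒∣m+n; *-cancelˡ-∣)
open import Data.Nat.GCD using (module Bézout)
open import Data.Nat.Primality using (Prime; euclidsLemma; prime⇒nonTrivial)
open import Data.Product using (_×_; _,_; ∃; proj₁; proj₂)
open import Data.Sum using (_⊎_; inj₁; inj₂)
open import Data.Vec using (_∷_; [])
open import Data.Vec.Properties
  using (zipWith-assoc; zipWith-comm; zipWith-identityˡ; zipWith-inverseˡ; ∷-injective; ∷-injectiveˡ; ∷-injectiveʳ)
import Data.Vec.Properties as Vec
open import Function using (id; _∘_)
open import Function.Bundles using (Bijection; mk⇔)
open import Relation.Binary.Definitions using (Decidable; DecidableEquality)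
open import Relation.Nullary using (¬_; Dec; does; yes; no)
open import Relation.Nullary.Decidable using (dec-true; dec-false)
open import Relation.Nullary.Negation using (contradiction)
open import Relation.Binary.PropositionalEquality as ≡ using (_≡_; _≢_; module ≡-Reasoning)

module ListSum {c ℓ : Level} (M : CommutativeMonoid c ℓ) where

  open CommutativeMonoid M
  open import Relation.Binary.Reasoning.Setoid setoid

  ∑ : ∀ {a} {A : Set a} → List A → (A → Carrier) → Carrier
  ∑ []       f = ε
  ∑ (x ∷ xs) f = f x ∙ ∑ xs f

  infix 5 ∑
  syntax ∑ xs (λ x → e) = ∑[ x ∈ xs ] e

  module _ {a} {A : Set a} where

    ∑-cong-∈ : ∀ (xs : List A) {f g} → (∀ {x} → x ∈ xs → f x ≈ g x) → ∑ xs f ≈ ∑ xs g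
    ∑-cong-∈ []       e = refl
    ∑-cong-∈ (x ∷ xs) e = ∙-cong (e (here ≡.refl)) (∑-cong-∈ xs (λ x∈xs → e (there x∈xs)))

    ∑-cong : ∀ (xs : List A) {f g} → (∀ x → f x ≈ g x) → ∑ xs f ≈ ∑ xs g
    ∑-cong xs e = ∑-cong-∈ xs (λ {x} _ → e x)

    ∑-++ : ∀ (xs ys : List A) f → ∑ (xs ++ ys) f ≈ ∑ xs f ∙ ∑ ys f
    ∑-++ []       ys f = sym (identityˡ _)
    ∑-++ (x ∷ xs) ys f = trans (∙-congˡ (∑-++ xs ys f)) (sym (assoc _ _ _))

    ∑-ε : ∀ (xs : List A) → ∑[ x ∈ xs ] ε ≈ ε
    ∑-ε []       = refl
    ∑-ε (x ∷ xs) = trans (identityˡ _) (∑-ε xs)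

    ∑-distrib-∙ : ∀ (xs : List A) f g → ∑[ x ∈ xs ] (f x ∙ g x) ≈ ∑ xs f ∙ ∑ xs g
    ∑-distrib-∙ []       f g = sym (identityˡ ε)
    ∑-distrib-∙ (x ∷ xs) f g = begin
      (f x ∙ g x) ∙ (∑[ y ∈ xs ] f y ∙ g y) ≈⟨ ∙-congˡ (∑-distrib-∙ xs f g) ⟩
      (f x ∙ g x) ∙ (∑ xs f ∙ ∑ xs g)       ≈⟨ interchange _ _ _ _ ⟩
      (f x ∙ ∑ xs f) ∙ (g x ∙ ∑ xs g)       ∎
      where open CommutativeSemigroupProperties commutativeSemigroup using (interchange)

    ∑-↭ : ∀ {xs ys : List A} f → xs ↭ ys → ∑ xs f ≈ ∑ ys f
    ∑-↭ f ↭.refl           = refl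
    ∑-↭ f (↭.prep x xs↭ys) = ∙-congˡ (∑-↭ f xs↭ys)
    ∑-↭ f (↭.swap x y xs↭ys) = begin
      f x ∙ (f y ∙ _) ≈⟨ sym (assoc _ _ _) ⟩
      (f x ∙ f y) ∙ _ ≈⟨ ∙-cong (comm _ _) (∑-↭ f xs↭ys) ⟩
      (f y ∙ f x) ∙ _ ≈⟨ assoc _ _ _ ⟩
      f y ∙ (f x ∙ _) ∎
    ∑-↭ f (↭.trans p q) = trans (∑-↭ f p) (∑-↭ f q)

    ∑-filterᵇ : ∀ (P : A → Bool) (xs : List A) f →
                ∑ (filterᵇ P xs) f ≈ ∑[ x ∈ xs ] (if P x then f x else ε)
    ∑-filterᵇ P []       f = refl
    ∑-filterᵇ P (x ∷ xs) f with P x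
    ... | true  = ∙-congˡ (∑-filterᵇ P xs f)
    ... | false = trans (∑-filterᵇ P xs f) (sym (identityˡ _))

    ∑-homo : (h : Carrier → Carrier) → (∀ {x y} → x ≈ y → h x ≈ h y) → h ε ≈ ε →
             (∀ x y → h (x ∙ y) ≈ h x ∙ h y) → ∀ (xs : List A) f → h (∑ xs f) ≈ ∑[ x ∈ xs ] h (f x)
    ∑-homo h h-cong h-ε h-∙ []       f = h-ε
    ∑-homo h h-cong h-ε h-∙ (x ∷ xs) f = trans (h-∙ _ _) (∙-congˡ (∑-homo h h-cong h-ε h-∙ xs f))

    ∑-δ : (_≟_ : DecidableEquality A) {xs : List A} {y : A} → Unique xs → y ∈ xs → ∀ v →
          ∑[ x ∈ xs ] (if does (x ≟ y) then v else ε) ≈ v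
    ∑-δ _≟_ {x ∷ xs} {y} (x∉xs ∷ xs!) (here ≡.refl) v with x ≟ x
    ... | no x≢x = contradiction ≡.refl x≢x
    ... | yes _  = trans (∙-congˡ (trans (∑-cong-∈ xs off) (∑-ε xs))) (identityʳ v)
      where
      off : ∀ {z} → z ∈ xs → (if does (z ≟ x) then v else ε) ≈ ε
      off {z} z∈xs with z ≟ x
      ... | yes ≡.refl = contradiction ≡.refl (All.lookup x∉xs z∈xs)
      ... | no _       = refl
    ∑-δ _≟_ {x ∷ xs} {y} (x∉xs ∷ xs!) (there y∈xs) v with x ≟ y
    ... | yes ≡.refl = contradiction ≡.refl (All.lookup x∉xs y∈xs)
    ... | no _       = trans (identityˡ _) (∑-δ _≟_ xs! y∈xs v)

  module _ {a b} {A : Set a} {B : Set b} where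

    ∑-map : ∀ (xs : List A) (g : A → B) f → ∑ (map g xs) f ≡ ∑[ x ∈ xs ] f (g x)
    ∑-map []       g f = ≡.refl
    ∑-map (x ∷ xs) g f = ≡.cong (f (g x) ∙_) (∑-map xs g f)

    ∑-concatMap : ∀ (xs : List A) (g : A → List B) f → ∑ (concatMap g xs) f ≈ ∑[ x ∈ xs ] ∑ (g x) f
    ∑-concatMap []       g f = refl
    ∑-concatMap (x ∷ xs) g f = trans (∑-++ (g x) _ f) (∙-congˡ (∑-concatMap xs g f))

    ∑-comm : ∀ (xs : List A) (ys : List B) (f : A → B → Carrier) →
             ∑[ x ∈ xs ] ∑[ y ∈ ys ] f x y ≈ ∑[ y ∈ ys ] ∑[ x ∈ xs ] f x y
    ∑-comm []       ys f = sym (∑-ε ys)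
    ∑-comm (x ∷ xs) ys f = trans (∙-congˡ (∑-comm xs ys f)) (sym (∑-distrib-∙ ys (f x) _))

module ℕ∑ = ListSum +-0-commutativeMonoid

∑ℕ : ∀ {a} {A : Set a} → List A → (A → ℕ) → ℕ
∑ℕ = ℕ∑.∑

infix 5 ∑ℕ
syntax ∑ℕ xs (λ x → e) = ∑ℕ[ x ∈ xs ] e

χ : Bool → ℕ
χ b = if b then 1 else 0

module _ {a} {A : Set a} where

  ∑ℕ-const : ∀ (xs : List A) c → ∑ℕ[ x ∈ xs ] c ≡ length xs * c
  ∑ℕ-const []       c = ≡.refl
  ∑ℕ-const (x ∷ xs) c = ≡.cong (c +_) (∑ℕ-const xs c)

  ∑ℕ-*ˡ : ∀ (xs : List A) k f → ∑ℕ[ x ∈ xs ] k * f x ≡ k * ∑ℕ xs f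
  ∑ℕ-*ˡ []       k f = ≡.sym (*-zeroʳ k)
  ∑ℕ-*ˡ (x ∷ xs) k f = ≡.trans (≡.cong (k * f x +_) (∑ℕ-*ˡ xs k f)) (≡.sym (*-distribˡ-+ k (f x) _))

  ∑ℕ-*ʳ : ∀ (xs : List A) k f → ∑ℕ[ x ∈ xs ] f x * k ≡ ∑ℕ xs f * k
  ∑ℕ-*ʳ []       k f = ≡.refl
  ∑ℕ-*ʳ (x ∷ xs) k f = ≡.trans (≡.cong (f x * k +_) (∑ℕ-*ʳ xs k f)) (≡.sym (*-distribʳ-+ k (f x) _))

  ∑ℕ-mono-≤ : ∀ (xs : List A) {f g} → (∀ {x} → x ∈ xs → f x ≤ g x) → ∑ℕ xs f ≤ ∑ℕ xs g
  ∑ℕ-mono-≤ []       f≤g = z≤n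
  ∑ℕ-mono-≤ (x ∷ xs) f≤g = +-mono-≤ (f≤g (here ≡.refl)) (∑ℕ-mono-≤ xs (λ x∈xs → f≤g (there x∈xs)))

  ∑ℕ-mono-< : ∀ (xs : List A) {f g} → (∀ x → f x ≤ g x) → ∀ {y} → y ∈ xs → f y < g y → ∑ℕ xs f < ∑ℕ xs g
  ∑ℕ-mono-< (x ∷ xs) f≤g (here ≡.refl) fy<gy = +-mono-<-≤ fy<gy (∑ℕ-mono-≤ xs (λ {z} _ → f≤g z))
  ∑ℕ-mono-< (x ∷ xs) f≤g (there y∈xs) fy<gy = +-mono-≤-< (f≤g x) (∑ℕ-mono-< xs f≤g y∈xs fy<gy)

  ∑ℕ-≥-term : ∀ (xs : List A) f {y} → y ∈ xs → f y ≤ ∑ℕ xs f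
  ∑ℕ-≥-term (x ∷ xs) f (here ≡.refl) = m≤m+n _ _
  ∑ℕ-≥-term (x ∷ xs) f (there y∈xs) = ≤-trans (∑ℕ-≥-term xs f y∈xs) (m≤n+m _ _)

  length-filterᵇ : ∀ (P : A → Bool) xs → length (filterᵇ P xs) ≡ ∑ℕ[ x ∈ xs ] χ (P x)
  length-filterᵇ P []       = ≡.refl
  length-filterᵇ P (x ∷ xs) with P x
  ... | true  = ≡.cong suc (length-filterᵇ P xs)
  ... | false = length-filterᵇ P xs

filterᵇ-cong : ∀ {a} {A : Set a} {P Q : A → Bool} → (∀ x → P x ≡ Q x) → ∀ xs → filterᵇ P xs ≡ filterᵇ Q xs
filterᵇ-cong P≗Q []       = ≡.refl
filterᵇ-cong {Q = Q} P≗Q (x ∷ xs) rewrite P≗Q x with Q x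
... | true  = ≡.cong (x ∷_) (filterᵇ-cong P≗Q xs)
... | false = filterᵇ-cong P≗Q xs

unique∧same-elements⇒↭ : ∀ {a} {A : Set a} {xs ys : List A} → Unique xs → Unique ys →
                         (∀ {x} → x ∈ xs → x ∈ ys) → (∀ {x} → x ∈ ys → x ∈ xs) → xs ↭ ys
unique∧same-elements⇒↭ xs! ys! xs⊆ys ys⊆xs = ∼bag⇒↭ (unique∧set⇒bag xs! ys! (mk⇔ xs⊆ys ys⊆xs))

p*d≤p^k : ∀ {p} .{{_ : NonZero p}} → Prime p → ∀ k {d} → d ∣ p ^ k → d < p ^ k → p * d ≤ p ^ k
p*d≤p^k {p} p-prime zero    {d} _ d<1 rewrite n<1⇒n≡0 d<1 | *-zeroʳ p = z≤n
p*d≤p^k {p} p-prime (suc k) {d} (divides e p^[1+k]≡e*d) d<p^[1+k]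
  with euclidsLemma d e p-prime (divides (p ^ k) (≡.trans (*-comm d e) (≡.trans (≡.sym p^[1+k]≡e*d) (*-comm p (p ^ k)))))
... | inj₁ (divides d′ ≡.refl) =
  *-monoʳ-≤ p (≤-trans (≤-reflexive (*-comm d′ p)) (p*d≤p^k p-prime k d′∣p^k d′<p^k))
  where
  d′∣p^k : d′ ∣ p ^ k
  d′∣p^k = *-cancelˡ-∣ p (divides e (≡.trans p^[1+k]≡e*d (≡.cong (e *_) (*-comm d′ p))))
  d′<p^k : d′ < p ^ k
  d′<p^k = *-cancelˡ-< p d′ (p ^ k) (≡.subst (_< p * p ^ k) (*-comm d′ p) d<p^[1+k])
... | inj₂ (divides e′ ≡.refl) = *-monoʳ-≤ p (∣⇒≤ {{m^n≢0 p k}} (divides e′ p^k≡e′*d))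
  where
  p^k≡e′*d : p ^ k ≡ e′ * d
  p^k≡e′*d = *-cancelˡ-≡ (p ^ k) (e′ * d) p
    (≡.trans p^[1+k]≡e*d (≡.trans (≡.cong (_* d) (*-comm e′ p)) (*-assoc p e′ d)))

coprime-^ : ∀ {n p} → Coprime n p → ∀ k → Coprime (p ^ k) n
coprime-^ n⊥p zero    (i∣1 , _)       = ∣1⇒≡1 i∣1
coprime-^ n⊥p (suc k) (i∣p*p^k , i∣n) =
  coprime-^ n⊥p k (coprime-divisor (λ (j∣i , j∣p) → n⊥p (∣-trans j∣i i∣n , j∣p)) i∣p*p^k , i∣n)

coprime-∣^ : ∀ {n p d} → Coprime n p → ∀ k → d ∣ p ^ k → Coprime d n
coprime-∣^ n⊥p k d∣p^k (j∣d , j∣n) = coprime-^ n⊥p k (∣-trans j∣d d∣p^k , j∣n)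

[P+Q]*P<p*[P*Q+P] : ∀ {p P Q} → 2 ≤ p → 0 < P → p * Q + 1 ≡ Q + P → (P + Q) * P < p * (P * Q + P)
[P+Q]*P<p*[P*Q+P] {p} {P} {Q} 2≤p 0<P pQ+1≡Q+P = begin-strict
  (P + Q) * P         ≡⟨ *-comm (P + Q) P ⟩
  P * (P + Q)         <⟨ *-monoʳ-< P {{>-nonZero 0<P}} (≤-reflexive (+-comm 1 (P + Q))) ⟩
  P * (P + Q + 1)     ≡⟨ ≡.cong (λ n → P * (n + 1)) (≡.trans (+-comm P Q) (≡.sym pQ+1≡Q+P)) ⟩
  P * (p * Q + 1 + 1) ≤⟨ *-monoʳ-≤ P (≤-trans (≤-reflexive (+-assoc (p * Q) 1 1)) (+-monoʳ-≤ (p * Q) 2≤p)) ⟩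
  P * (p * Q + p)     ≡⟨ *-distribˡ-+ P (p * Q) p ⟩
  P * (p * Q) + P * p ≡⟨ ≡.cong₂ _+_ (x∙yz≈y∙xz P p Q) (*-comm P p) ⟩
  p * (P * Q) + p * P ≡⟨ *-distribˡ-+ p (P * Q) P ⟨
  p * (P * Q + P)     ∎
  where
  open ≤-Reasoning
  open CommutativeSemigroupProperties *-commutativeSemigroup using (x∙yz≈y∙xz)

geometric-step : ∀ p P Q → p * Q + 1 ≡ Q + P → p * (P + Q) + 1 ≡ P + Q + p * P
geometric-step p P Q pQ+1≡Q+P = begin
  p * (P + Q) + 1     ≡⟨ ≡.cong (_+ 1) (*-distribˡ-+ p P Q) ⟩
  p * P + p * Q + 1   ≡⟨ +-assoc (p * P) (p * Q) 1 ⟩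
  p * P + (p * Q + 1) ≡⟨ ≡.cong (p * P +_) pQ+1≡Q+P ⟩
  p * P + (Q + P)     ≡⟨ +-comm (p * P) (Q + P) ⟩
  Q + P + p * P       ≡⟨ ≡.cong (_+ p * P) (+-comm Q P) ⟩
  P + Q + p * P       ∎
  where open ≡-Reasoning

dec-true⁻¹ : ∀ {a} {A : Set a} (a? : Dec A) → does a? ≡ true → A
dec-true⁻¹ (yes a) _ = a

does-⇔ : ∀ {a b} {A : Set a} {B : Set b} (a? : Dec A) (b? : Dec B) → (A → B) → (B → A) → does a? ≡ does b?
does-⇔ a? (yes b) A→B B→A = dec-true a? (B→A b)
does-⇔ a? (no ¬b) A→B B→A = dec-false a? (λ a → ¬b (A→B a))

∧-true : ∀ {a b} → a ∧ b ≡ true → a ≡ true × b ≡ true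
∧-true {true} {true} _ = ≡.refl , ≡.refl

∧-not-true : ∀ {a b} → a ∧ not b ≡ true → a ≡ true × b ≡ false
∧-not-true {true} {false} _ = ≡.refl , ≡.refl

χ-mono : ∀ {a b} → (a ≡ true → b ≡ true) → χ a ≤ χ b
χ-mono {false} _   = z≤n
χ-mono {true}  a⇒b rewrite a⇒b ≡.refl = ≤-refl

χ-∧-not : ∀ a b → (b ≡ true → a ≡ true) → χ a ≡ χ (a ∧ not b) + χ b
χ-∧-not a     true  b⇒a rewrite b⇒a ≡.refl = ≡.refl
χ-∧-not true  false _   = ≡.refl
χ-∧-not false false _   = ≡.refl

χ-∧ : ∀ a b → χ (a ∧ b) ≡ χ a * χ b
χ-∧ true  b = ≡.sym (+-identityʳ (χ b))
χ-∧ false b = ≡.refl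

module PrimeField (p : ℕ) {{_ : NonZero p}} where

  open ≡ using (refl; sym; trans; cong; cong₂; isEquivalence)

  infixl 6 _⊕_
  infixl 7 _⊛_
  infix  8 ⊖_

  [_] : ℕ → Fin p
  [ m ] = m mod p

  _⊕_ : Fin p → Fin p → Fin p
  _⊕_ = _+F_ p

  ⊖_ : Fin p → Fin p
  ⊖_ = -F_ p

  _⊛_ : Fin p → Fin p → Fin p
  a ⊛ b = [ toℕ a * toℕ b ]

  𝟘 𝟙 : Fin p
  𝟘 = [ 0 ]
  𝟙 = [ 1 ]

  toℕ-[] : ∀ m → toℕ [ m ] ≡ m % p
  toℕ-[] m = toℕ-fromℕ< _

  []-toℕ : ∀ a → [ toℕ a ] ≡ a
  []-toℕ a = toℕ-injective (trans (toℕ-[] (toℕ a)) (m<n⇒m%n≡m (toℕ<n a)))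

  []-cong-% : ∀ {m n} → m % p ≡ n % p → [ m ] ≡ [ n ]
  []-cong-% e = toℕ-injective (trans (toℕ-[] _) (trans e (sym (toℕ-[] _))))

  []≡𝟘 : ∀ {m} → m % p ≡ 0 → [ m ] ≡ 𝟘
  []≡𝟘 m%p≡0 = []-cong-% (trans m%p≡0 (sym (m<n⇒m%n≡m (>-nonZero⁻¹ p))))

  ⊕-[] : ∀ m n → [ m ] ⊕ [ n ] ≡ [ m + n ]
  ⊕-[] m n = []-cong-% (trans (cong₂ (λ x y → (x + y) % p) (toℕ-[] m) (toℕ-[] n))
                                (sym (%-distribˡ-+ m n p)))

  ⊛-[] : ∀ m n → [ m ] ⊛ [ n ] ≡ [ m * n ]
  ⊛-[] m n = []-cong-% (trans (cong₂ (λ x y → (x * y) % p) (toℕ-[] m) (toℕ-[] n))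
                                (sym (%-distribˡ-* m n p)))

  ⊕-[]ˡ : ∀ m a → [ m ] ⊕ a ≡ [ m + toℕ a ]
  ⊕-[]ˡ m a = trans (cong ([ m ] ⊕_) (sym ([]-toℕ a))) (⊕-[] m (toℕ a))

  ⊛-[]ˡ : ∀ m a → [ m ] ⊛ a ≡ [ m * toℕ a ]
  ⊛-[]ˡ m a = trans (cong ([ m ] ⊛_) (sym ([]-toℕ a))) (⊛-[] m (toℕ a))

  ⊕-comm : ∀ a b → a ⊕ b ≡ b ⊕ a
  ⊕-comm a b = cong [_] (+-comm (toℕ a) (toℕ b))

  ⊛-comm : ∀ a b → a ⊛ b ≡ b ⊛ a
  ⊛-comm a b = cong [_] (*-comm (toℕ a) (toℕ b))

  ⊕-assoc : ∀ a b c → (a ⊕ b) ⊕ c ≡ a ⊕ (b ⊕ c)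
  ⊕-assoc a b c = begin
    [ toℕ a + toℕ b ] ⊕ c         ≡⟨ ⊕-[]ˡ _ c ⟩
    [ toℕ a + toℕ b + toℕ c ]     ≡⟨ cong [_] (+-assoc (toℕ a) _ _) ⟩
    [ toℕ a + (toℕ b + toℕ c) ]   ≡⟨ cong [_] (+-comm (toℕ a) _) ⟩
    [ toℕ b + toℕ c + toℕ a ]     ≡⟨ ⊕-[]ˡ _ a ⟨
    (b ⊕ c) ⊕ a                   ≡⟨ ⊕-comm (b ⊕ c) a ⟩
    a ⊕ (b ⊕ c)                   ∎
    where open ≡-Reasoning

  ⊛-assoc : ∀ a b c → (a ⊛ b) ⊛ c ≡ a ⊛ (b ⊛ c)
  ⊛-assoc a b c = begin
    [ toℕ a * toℕ b ] ⊛ c         ≡⟨ ⊛-[]ˡ _ c ⟩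
    [ toℕ a * toℕ b * toℕ c ]     ≡⟨ cong [_] (*-assoc (toℕ a) _ _) ⟩
    [ toℕ a * (toℕ b * toℕ c) ]   ≡⟨ cong [_] (*-comm (toℕ a) _) ⟩
    [ toℕ b * toℕ c * toℕ a ]     ≡⟨ ⊛-[]ˡ _ a ⟨
    (b ⊛ c) ⊛ a                   ≡⟨ ⊛-comm (b ⊛ c) a ⟩
    a ⊛ (b ⊛ c)                   ∎
    where open ≡-Reasoning

  ⊛-distribʳ-⊕ : ∀ a b c → (b ⊕ c) ⊛ a ≡ b ⊛ a ⊕ c ⊛ a
  ⊛-distribʳ-⊕ a b c = begin
    [ toℕ b + toℕ c ] ⊛ a               ≡⟨ ⊛-[]ˡ _ a ⟩
    [ (toℕ b + toℕ c) * toℕ a ]         ≡⟨ cong [_] (*-distribʳ-+ (toℕ a) (toℕ b) _) ⟩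
    [ toℕ b * toℕ a + toℕ c * toℕ a ]   ≡⟨ ⊕-[] _ _ ⟨
    b ⊛ a ⊕ c ⊛ a                       ∎
    where open ≡-Reasoning

  ⊕-identityˡ : ∀ a → 𝟘 ⊕ a ≡ a
  ⊕-identityˡ a = trans (⊕-[]ˡ 0 a) ([]-toℕ a)

  ⊛-identityˡ : ∀ a → 𝟙 ⊛ a ≡ a
  ⊛-identityˡ a = trans (⊛-[]ˡ 1 a) (trans (cong [_] (*-identityˡ (toℕ a))) ([]-toℕ a))

  ⊕-inverseˡ : ∀ a → ⊖ a ⊕ a ≡ 𝟘
  ⊕-inverseˡ a = begin
    [ p ∸ toℕ a ] ⊕ a       ≡⟨ ⊕-[]ˡ _ a ⟩
    [ p ∸ toℕ a + toℕ a ]   ≡⟨ cong [_] (m∸n+n≡m (<⇒≤ (toℕ<n a))) ⟩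
    [ p ]                   ≡⟨ []≡𝟘 (n%n≡0 p) ⟩
    𝟘                       ∎
    where open ≡-Reasoning

  commutativeRing : CommutativeRing 0ℓ 0ℓ
  commutativeRing = record
    { Carrier = Fin p ; _≈_ = _≡_ ; _+_ = _⊕_ ; _*_ = _⊛_ ; -_ = ⊖_ ; 0# = 𝟘 ; 1# = 𝟙
    ; isCommutativeRing = record
      { isRing = record
        { +-isAbelianGroup = record
          { isGroup = record
            { isMonoid = record
              { isSemigroup = record { isMagma = record { isEquivalence = isEquivalence ; ∙-cong = cong₂ _⊕_ }
                                     ; assoc = ⊕-assoc }
              ; identity = ⊕-identityˡ , λ a → trans (⊕-comm a 𝟘) (⊕-identityˡ a) }
            ; inverse = ⊕-inverseˡ , λ a → trans (⊕-comm a (⊖ a)) (⊕-inverseˡ a)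
            ; ⁻¹-cong = cong ⊖_ }
          ; comm = ⊕-comm }
        ; *-cong = cong₂ _⊛_
        ; *-assoc = ⊛-assoc
        ; *-identity = ⊛-identityˡ , λ a → trans (⊛-comm a 𝟙) (⊛-identityˡ a)
        ; distrib = (λ a b c → trans (⊛-comm a (b ⊕ c))
                                     (trans (⊛-distribʳ-⊕ a b c) (cong₂ _⊕_ (⊛-comm b a) (⊛-comm c a))))
                  , ⊛-distribʳ-⊕ }
      ; *-comm = ⊛-comm } }

  module 𝔽 where
    open CommutativeRing commutativeRing public
    open RingProperties (CommutativeRing.ring commutativeRing) public
    open CommutativeSemigroupProperties +-commutativeSemigroup public
      using () renaming (interchange to +-interchange)

  ⊕-solveʳ : ∀ x y s → x ⊕ y ≡ s → y ≡ ⊖ x ⊕ s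
  ⊕-solveʳ x y s x+y≡s = trans (sym (𝔽.\\-leftDividesʳ x y)) (cong (⊖ x ⊕_) x+y≡s)

  ⊕-solveʳ⁻¹ : ∀ x y s → y ≡ ⊖ x ⊕ s → x ⊕ y ≡ s
  ⊕-solveʳ⁻¹ x y s refl = 𝔽.\\-leftDividesˡ x s

  ⊛-solveʳ : ∀ {u t} → u ⊛ t ≡ 𝟙 → ∀ x s → x ⊛ t ≡ s → x ≡ s ⊛ u
  ⊛-solveʳ {u} {t} u*t≡𝟙 x s x*t≡s = begin
    x             ≡⟨ 𝔽.*-identityʳ x ⟨
    x ⊛ 𝟙         ≡⟨ cong (x ⊛_) (trans (sym u*t≡𝟙) (⊛-comm u t)) ⟩
    x ⊛ (t ⊛ u)   ≡⟨ ⊛-assoc x t u ⟨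
    (x ⊛ t) ⊛ u   ≡⟨ cong (_⊛ u) x*t≡s ⟩
    s ⊛ u         ∎
    where open ≡-Reasoning

  ⊛-solveʳ⁻¹ : ∀ {u t} → u ⊛ t ≡ 𝟙 → ∀ x s → x ≡ s ⊛ u → x ⊛ t ≡ s
  ⊛-solveʳ⁻¹ {u} {t} u*t≡𝟙 x s refl = trans (⊛-assoc s u t) (trans (cong (s ⊛_) u*t≡𝟙) (𝔽.*-identityʳ s))

  module _ (p-prime : Prime p) where

    𝟙≢𝟘 : 𝟙 ≢ 𝟘
    𝟙≢𝟘 e = 1+n≢0 (begin
      1          ≡⟨ m<n⇒m%n≡m (nonTrivial⇒n>1 p {{prime⇒nonTrivial p-prime}}) ⟨
      1 % p      ≡⟨ toℕ-[] 1 ⟨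
      toℕ 𝟙      ≡⟨ cong toℕ e ⟩
      toℕ 𝟘      ≡⟨ toℕ-[] 0 ⟩
      0 % p      ≡⟨ m<n⇒m%n≡m (>-nonZero⁻¹ p) ⟩
      0          ∎)
      where open ≡-Reasoning

    ⊛-inverse : ∀ t → t ≢ 𝟘 → ∃ λ u → u ⊛ t ≡ 𝟙
    ⊛-inverse t t≢𝟘 with coprime-Bézout (Coprime.sym (prime⇒coprime p-prime {{≢-nonZero toℕt≢0}} (toℕ<n t)))
      where
      toℕt≢0 : toℕ t ≢ 0
      toℕt≢0 toℕt≡0 = t≢𝟘 (trans (sym ([]-toℕ t)) (cong [_] toℕt≡0))
    ... | Bézout.+- x y 1+yp≡xt = [ x ] , (begin
      [ x ] ⊛ t           ≡⟨ ⊛-[]ˡ x t ⟩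
      [ x * toℕ t ]       ≡⟨ cong [_] 1+yp≡xt ⟨
      [ 1 + y * p ]       ≡⟨ []-cong-% ([m+kn]%n≡m%n 1 y p) ⟩
      𝟙                   ∎)
      where open ≡-Reasoning
    ... | Bézout.-+ x y 1+xt≡yp = ⊖ [ x ] , (begin
      ⊖ [ x ] ⊛ t         ≡⟨ 𝔽.-‿distribˡ-* [ x ] t ⟨
      ⊖ ([ x ] ⊛ t)       ≡⟨ cong ⊖_ (𝔽.+-inverseʳ-unique 𝟙 ([ x ] ⊛ t) 𝟙+xt≡𝟘) ⟩
      ⊖ ⊖ 𝟙               ≡⟨ 𝔽.-‿involutive 𝟙 ⟩
      𝟙                   ∎)
      where
      open ≡-Reasoning
      𝟙+xt≡𝟘 : 𝟙 ⊕ [ x ] ⊛ t ≡ 𝟘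
      𝟙+xt≡𝟘 = begin
        𝟙 ⊕ [ x ] ⊛ t           ≡⟨ cong (𝟙 ⊕_) (⊛-[]ˡ x t) ⟩
        [ 1 ] ⊕ [ x * toℕ t ]   ≡⟨ ⊕-[] 1 _ ⟩
        [ 1 + x * toℕ t ]       ≡⟨ cong [_] 1+xt≡yp ⟩
        [ y * p ]               ≡⟨ []≡𝟘 (m*n%n≡0 y p) ⟩
        𝟘                       ∎

module Vectors (p : ℕ) {{_ : NonZero p}} where

  open ≡ using (refl; sym; trans; cong; cong₂; subst; isEquivalence)

  open PrimeField p

  V : ℕ → Set
  V = G p

  infixl 6 _+V_
  infix  8 -V_

  _+V_ : ∀ {r} → V r → V r → V r
  _+V_ {r} = _+G_ p r

  -V_ : ∀ {r} → V r → V r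
  -V_ {r} = -G_ p r

  0V : ∀ r → V r
  0V = 0G p

  abelianGroup : ℕ → AbelianGroup 0ℓ 0ℓ
  abelianGroup r = record
    { Carrier = V r ; _≈_ = _≡_ ; _∙_ = _+V_ ; ε = 0V r ; _⁻¹ = -V_
    ; isAbelianGroup = record
      { isGroup = record
        { isMonoid = record
          { isSemigroup = record { isMagma = record { isEquivalence = isEquivalence ; ∙-cong = cong₂ _+V_ }
                                 ; assoc = zipWith-assoc 𝔽.+-assoc }
          ; identity = zipWith-identityˡ 𝔽.+-identityˡ , λ u → trans (+V-comm u (0V r)) (zipWith-identityˡ 𝔽.+-identityˡ u) }
        ; inverse = zipWith-inverseˡ 𝔽.-‿inverseˡ , λ u → trans (+V-comm u (-V u)) (zipWith-inverseˡ 𝔽.-‿inverseˡ u)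
        ; ⁻¹-cong = cong -V_ }
      ; comm = +V-comm } }
    where
    +V-comm : ∀ (u v : V r) → u +V v ≡ v +V u
    +V-comm = zipWith-comm 𝔽.+-comm

  module 𝕍 {r : ℕ} where
    open AbelianGroup (abelianGroup r) public
    open AbelianGroupProperties (abelianGroup r) public

  dot : ∀ {r} → V r → V r → Fin p
  dot []      []      = 𝟘
  dot (x ∷ a) (y ∷ b) = x ⊛ y ⊕ dot a b

  dot-comm : ∀ {r} (a b : V r) → dot a b ≡ dot b a
  dot-comm []      []      = refl
  dot-comm (x ∷ a) (y ∷ b) = cong₂ _⊕_ (𝔽.*-comm x y) (dot-comm a b)

  dot-zeroʳ : ∀ {r} (a : V r) → dot a (0V r) ≡ 𝟘
  dot-zeroʳ []      = refl
  dot-zeroʳ (x ∷ a) = trans (cong₂ _⊕_ (𝔽.zeroʳ x) (dot-zeroʳ a)) (𝔽.+-identityˡ 𝟘)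

  dot-zeroˡ : ∀ {r} (b : V r) → dot (0V r) b ≡ 𝟘
  dot-zeroˡ b = trans (dot-comm _ b) (dot-zeroʳ b)

  dot-distribˡ : ∀ {r} (a u v : V r) → dot a (u +V v) ≡ dot a u ⊕ dot a v
  dot-distribˡ []      []      []      = sym (𝔽.+-identityˡ 𝟘)
  dot-distribˡ (x ∷ a) (y ∷ u) (z ∷ v) = begin
    x ⊛ (y ⊕ z) ⊕ dot a (u +V v)              ≡⟨ cong₂ _⊕_ (𝔽.distribˡ x y z) (dot-distribˡ a u v) ⟩
    (x ⊛ y ⊕ x ⊛ z) ⊕ (dot a u ⊕ dot a v)     ≡⟨ 𝔽.+-interchange (x ⊛ y) (x ⊛ z) (dot a u) (dot a v) ⟩
    (x ⊛ y ⊕ dot a u) ⊕ (x ⊛ z ⊕ dot a v)     ∎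
    where open ≡-Reasoning

  dot-negʳ : ∀ {r} (a u : V r) → dot a (-V u) ≡ ⊖ dot a u
  dot-negʳ {r} a u = 𝔽.+-inverseʳ-unique (dot a u) (dot a (-V u)) (begin
    dot a u ⊕ dot a (-V u) ≡⟨ dot-distribˡ a u (-V u) ⟨
    dot a (u +V -V u)     ≡⟨ cong (dot a) (𝕍.inverseʳ u) ⟩
    dot a (0V r)          ≡⟨ dot-zeroʳ a ⟩
    𝟘                     ∎)
    where open ≡-Reasoning

  allG-suc : ∀ r → allG p (suc r) ≡ cartesianProductWith _∷_ (allFin p) (allG p r)
  allG-suc r = go (allFin p)
    where
    go : ∀ (as : List (Fin p)) → concatMap (λ a → map (a ∷_) (allG p r)) as ≡ cartesianProductWith _∷_ as (allG p r)
    go []       = refl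
    go (a ∷ as) = cong (map (a ∷_) (allG p r) ++_) (go as)

  ∈-allG : ∀ {r} (v : V r) → v ∈ allG p r
  ∈-allG []              = here refl
  ∈-allG {suc r} (a ∷ v) = subst (a ∷ v ∈_) (sym (allG-suc r))
    (∈-cartesianProductWith⁺ _∷_ (∈-allFin a) (∈-allG v))

  allG-unique : ∀ r → Unique (allG p r)
  allG-unique zero    = All.[] ∷ []
  allG-unique (suc r) = subst Unique (sym (allG-suc r))
    (Unique.cartesianProductWith⁺ _∷_ ∷-injective (Unique.allFin⁺ p) (allG-unique r))

  allG-translate : ∀ {r} (σ : V r) → map (σ +V_) (allG p r) ↭ allG p r
  allG-translate {r} σ = unique∧same-elements⇒↭
    (Unique.map⁺ (𝕍.∙-cancelˡ σ _ _) (allG-unique r))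
    (allG-unique r)
    (λ _ → ∈-allG _)
    (λ {y} _ → subst (_∈ map (σ +V_) (allG p r)) (𝕍.\\-leftDividesˡ σ y) (∈-map⁺ (σ +V_) (∈-allG (-V σ +V y))))

module Counting (p : ℕ) {{_ : NonZero p}} where

  open ≡ using (refl; sym; trans; cong; cong₂; subst)

  open Vectors p

  count : ∀ r → Subset p r → ℕ
  count r S = ∑ℕ[ x ∈ allG p r ] χ (S x)

  infix 4 _⊆_
  record _⊆_ {r} (S T : Subset p r) : Set where
    constructor ⊆-intro
    field ⊆-elim : ∀ {x} → S x ≡ true → T x ≡ true
  open _⊆_ public

  infixl 6 _∖_
  _∖_ : ∀ {r} → Subset p r → Subset p r → Subset p r
  (S ∖ T) x = S x ∧ not (T x)

  card≡count : ∀ r S → card p r S ≡ count r S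
  card≡count r S = length-filterᵇ S (allG p r)

  count-∷ : ∀ r (S : Subset p (suc r)) → count (suc r) S ≡ ∑ℕ[ a ∈ allFin p ] count r (λ v → S (a ∷ v))
  count-∷ r S = trans (ℕ∑.∑-concatMap (allFin p) (λ a → map (a ∷_) (allG p r)) (λ x → χ (S x)))
                      (ℕ∑.∑-cong (allFin p) (λ a → ℕ∑.∑-map (allG p r) (a ∷_) (λ x → χ (S x))))

  count-cong : ∀ {r} {S T : Subset p r} → (∀ x → S x ≡ T x) → count r S ≡ count r T
  count-cong {r} S≗T = ℕ∑.∑-cong (allG p r) (λ x → cong χ (S≗T x))

  ∑ℕ-allFin-const : ∀ c → ∑ℕ[ a ∈ allFin p ] c ≡ p * c
  ∑ℕ-allFin-const c = trans (∑ℕ-const (allFin p) c) (cong (_* c) (length-tabulate {n = p} id))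

  count-whole : ∀ r → count r (whole p r) ≡ p ^ r
  count-whole zero    = refl
  count-whole (suc r) = begin
    count (suc r) (whole p (suc r))          ≡⟨ count-∷ r (whole p (suc r)) ⟩
    ∑ℕ[ a ∈ allFin p ] count r (whole p r)   ≡⟨ ℕ∑.∑-cong (allFin p) (λ _ → count-whole r) ⟩
    ∑ℕ[ a ∈ allFin p ] p ^ r                 ≡⟨ ∑ℕ-allFin-const (p ^ r) ⟩
    p * p ^ r                                ∎
    where open ≡-Reasoning

  length-allG : ∀ r → length (allG p r) ≡ p ^ r
  length-allG r = trans (sym (*-identityʳ _)) (trans (sym (∑ℕ-const (allG p r) 1)) (count-whole r))

  count-const : ∀ r b → count r (λ _ → b) ≡ p ^ r * χ b
  count-const r b = trans (∑ℕ-const (allG p r) (χ b)) (cong (_* χ b) (length-allG r))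

  count-translate : ∀ {r} (σ : V r) (S : Subset p r) → count r (λ x → S (σ +V x)) ≡ count r S
  count-translate {r} σ S = trans (sym (ℕ∑.∑-map (allG p r) (σ +V_) (λ x → χ (S x))))
                                  (ℕ∑.∑-↭ (λ x → χ (S x)) (allG-translate σ))

  count-mono-< : ∀ {r} {S T : Subset p r} → S ⊆ T → ∀ {y} → S y ≡ false → T y ≡ true → count r S < count r T
  count-mono-< {r} {S} {T} S⊆T {y} y∉S y∈T =
    ∑ℕ-mono-< (allG p r) (λ _ → χ-mono (⊆-elim S⊆T)) (∈-allG y) (χ-strict y∉S y∈T)
    where
    χ-strict : S y ≡ false → T y ≡ true → χ (S y) < χ (T y)
    χ-strict eS eT rewrite eS | eT = s≤s z≤n

  count-pos : ∀ {r} {S : Subset p r} {y} → S y ≡ true → 0 < count r S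
  count-pos {r} {S} {y} y∈S = subst (_≤ count r S) (cong χ y∈S) (∑ℕ-≥-term (allG p r) (λ x → χ (S x)) (∈-allG y))

  count-∅ : ∀ {r} {S : Subset p r} → (∀ x → S x ≡ false) → count r S ≡ 0
  count-∅ {r} S≡∅ = trans (ℕ∑.∑-cong (allG p r) (λ x → cong χ (S≡∅ x))) (ℕ∑.∑-ε (allG p r))

  count-∖ : ∀ {r} {S T : Subset p r} → T ⊆ S → count r S ≡ count r (S ∖ T) + count r T
  count-∖ {r} {S} {T} T⊆S = trans (ℕ∑.∑-cong (allG p r) (λ x → χ-∧-not (S x) (T x) (⊆-elim T⊆S)))
                                  (ℕ∑.∑-distrib-∙ (allG p r) (λ x → χ ((S ∖ T) x)) (λ x → χ (T x)))

  ⊆∧count≤⇒⊇ : ∀ {r} {S T : Subset p r} → S ⊆ T → count r T ≤ count r S → T ⊆ S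
  ⊆∧count≤⇒⊇ {r} {S} {T} S⊆T T≤S = ⊆-intro λ {y} y∈T → T⊆S y y∈T
    where
    T⊆S : ∀ y → T y ≡ true → S y ≡ true
    T⊆S y y∈T with S y in y∈?S
    ... | true  = refl
    ... | false = contradiction T≤S (<⇒≱ (count-mono-< S⊆T y∈?S y∈T))

  inhabited? : ∀ {r} (S : Subset p r) → (∃ λ x → S x ≡ true) ⊎ (∀ x → S x ≡ false)
  inhabited? {r} S with any? (λ x → S x Bool.≟ true) (allG p r)
  ... | yes some = let x , _ , x∈S = find some in inj₁ (x , x∈S)
  ... | no  none = inj₂ (λ x → ¬-not (λ x∈S → none (lose (∈-allG x) x∈S)))

  infixr 7 _∩_
  _∩_ : ∀ {r} → Subset p r → Subset p r → Subset p r
  (S ∩ T) x = S x ∧ T x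

  ∩⊆ˡ : ∀ {r} {S T : Subset p r} → S ∩ T ⊆ S
  ∩⊆ˡ {S = S} = ⊆-intro λ {x} x∈S∩T → proj₁ (∧-true {S x} x∈S∩T)

  ⊆-antisym : ∀ {r} {S T : Subset p r} → S ⊆ T → T ⊆ S → SameSubset p r S T
  ⊆-antisym {S = S} {T} S⊆T T⊆S x with S x in x∈?S | T x in x∈?T
  ... | true  | true  = refl
  ... | false | false = refl
  ... | true  | false = contradiction (trans (sym x∈?T) (⊆-elim S⊆T x∈?S)) λ ()
  ... | false | true  = contradiction (trans (sym x∈?S) (⊆-elim T⊆S x∈?T)) λ ()

  ⊆-or-witness : ∀ {r} (S T : Subset p r) → S ⊆ T ⊎ ∃ λ x → S x ≡ true × T x ≡ false
  ⊆-or-witness S T with inhabited? (S ∖ T)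
  ... | inj₁ (x , x∈S∖T) = inj₂ (x , ∧-not-true {S x} x∈S∖T)
  ... | inj₂ S∖T≡∅       = inj₁ (⊆-intro λ {x} x∈S → T∋ x x∈S (S∖T≡∅ x))
    where
    T∋ : ∀ x → S x ≡ true → (S ∖ T) x ≡ false → T x ≡ true
    T∋ x x∈S x∉S∖T with T x
    ... | true  = refl
    ... | false = trans (sym x∉S∖T) (cong (_∧ true) x∈S)

  _⊆?_ : ∀ {r} (S T : Subset p r) → Dec (S ⊆ T)
  S ⊆? T with ⊆-or-witness S T
  ... | inj₁ S⊆T             = yes S⊆T
  ... | inj₂ (x , x∈S , x∉T) = no (λ S⊆T → contradiction (trans (sym x∉T) (⊆-elim S⊆T x∈S)) (λ ()))

  ∩-subgroup : ∀ {r} {S T : Subset p r} → IsSubgroup p r S → IsSubgroup p r T → IsSubgroup p r (S ∩ T)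
  ∩-subgroup {S = S} {T} (S-0 , S-+ , S-neg) (T-0 , T-+ , T-neg) =
    cong₂ _∧_ S-0 T-0 ,
    (λ g h g∈ h∈ → let g∈S , g∈T = ∧-true {S g} g∈ ; h∈S , h∈T = ∧-true {S h} h∈
                   in cong₂ _∧_ (S-+ g h g∈S h∈S) (T-+ g h g∈T h∈T)) ,
    (λ g g∈ → let g∈S , g∈T = ∧-true {S g} g∈ in cong₂ _∧_ (S-neg g g∈S) (T-neg g g∈T))

  whole-subgroup : ∀ r → IsSubgroup p r (whole p r)
  whole-subgroup r = refl , (λ _ _ _ _ → refl) , (λ _ _ → refl)

  module _ {r} {K : Subset p r} (K-subgroup : IsSubgroup p r K) where

    Invariant : Subset p r → Set
    Invariant S = ∀ {x k} → S x ≡ true → K k ≡ true → S (x +V k) ≡ true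

    coset : V r → Subset p r
    coset x y = K (-V x +V y)

    coset⊆ : ∀ {S x} → Invariant S → S x ≡ true → coset x ⊆ S
    coset⊆ {S} {x} S-inv x∈S = ⊆-intro λ {y} y∈x+K →
      subst (λ z → S z ≡ true) (𝕍.\\-leftDividesˡ x y) (S-inv x∈S y∈x+K)

    ∖coset-invariant : ∀ {S x} → Invariant S → Invariant (S ∖ coset x)
    ∖coset-invariant {S} {x} S-inv {y} {k} y∈S∖x+K k∈K with ∧-not-true {S y} y∈S∖x+K
    ... | y∈S , y∉x+K = cong₂ _∧_ (S-inv y∈S k∈K) (cong not y+k∉x+K)
      where
      y+k∉x+K : K (-V x +V (y +V k)) ≡ false
      y+k∉x+K with K (-V x +V (y +V k)) in y+k∈x+K
      ... | false = refl
      ... | true  = contradiction (trans (sym y∉x+K) y∈x+K) λ ()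
        where
        shift : (-V x +V (y +V k)) +V -V k ≡ -V x +V y
        shift = trans (𝕍.assoc (-V x) (y +V k) (-V k)) (cong (-V x +V_) (𝕍.//-rightDividesʳ k y))
        y∈x+K : K (-V x +V y) ≡ true
        y∈x+K = let _ , K-+ , K-neg = K-subgroup in
          subst (λ z → K z ≡ true) shift (K-+ (-V x +V (y +V k)) (-V k) y+k∈x+K (K-neg k k∈K))

    count-∣ : ∀ {S} → Invariant S → count r K ∣ count r S
    count-∣ {S} = go (count r S) ≤-refl
      where
      go : ∀ n {S} → count r S ≤ n → Invariant S → count r K ∣ count r S
      go zero    S≤0 _ = subst (count r K ∣_) (sym (n≤0⇒n≡0 S≤0)) (count r K ∣0)
      go (suc n) {S} S≤1+n S-inv with inhabited? S
      ... | inj₂ S≡∅       = subst (count r K ∣_) (sym (count-∅ S≡∅)) (count r K ∣0)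
      ... | inj₁ (x , x∈S) =
        subst (count r K ∣_) (sym S≡S′+K) (∣m∣n⇒∣m+n (go n S′≤n (∖coset-invariant {S} {x} S-inv)) ∣-refl)
        where
        S≡S′+K : count r S ≡ count r (S ∖ coset x) + count r K
        S≡S′+K = trans (count-∖ (coset⊆ S-inv x∈S)) (cong (count r (S ∖ coset x) +_) (count-translate (-V x) K))
        S′≤n : count r (S ∖ coset x) ≤ n
        S′≤n = ≤-pred (<-≤-trans (m<m+n _ (count-pos {S = K} (proj₁ K-subgroup)))
                                 (≤-trans (≤-reflexive (sym S≡S′+K)) S≤1+n))

  lagrange : ∀ {r} {K H : Subset p r} → IsSubgroup p r K → IsSubgroup p r H → K ⊆ H → count r K ∣ count r H
  lagrange K-subgroup (_ , H-+ , _) K⊆H = count-∣ K-subgroup (λ {x} {k} x∈H k∈K → H-+ x k x∈H (⊆-elim K⊆H k∈K))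

  count-subgroup-∣ : ∀ {r} {H : Subset p r} → IsSubgroup p r H → count r H ∣ p ^ r
  count-subgroup-∣ {r} {H} H-subgroup =
    subst (count r H ∣_) (count-whole r) (lagrange H-subgroup (whole-subgroup r) (⊆-intro (λ _ → refl)))

  module _ (p-prime : Prime p) where

    proper-subgroup-bound : ∀ {r k} {K H : Subset p r} → IsSubgroup p r K → IsSubgroup p r H → K ⊆ H →
                            ∀ {τ} → H τ ≡ true → K τ ≡ false → count r H ≡ p ^ k → p * count r K ≤ p ^ k
    proper-subgroup-bound {r} {k} {K} K-subgroup H-subgroup K⊆H τ∈H τ∉K H≡p^k =
      p*d≤p^k p-prime k (subst (count r K ∣_) H≡p^k (lagrange K-subgroup H-subgroup K⊆H))
                        (subst (count r K <_) H≡p^k (count-mono-< K⊆H τ∉K τ∈H))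

    index-p-maximal : ∀ {r} {H K : Subset p r} → HasIndexP p r H → IsSubgroup p r K → H ⊆ K →
                      ∀ {τ} → K τ ≡ true → H τ ≡ false → ∀ σ → K σ ≡ true
    index-p-maximal {r} {H} {K} H-index K-subgroup H⊆K τ∈K τ∉H σ with K σ in σ∈K
    ... | true  = refl
    ... | false = contradiction K≤H (<⇒≱ (count-mono-< H⊆K τ∉H τ∈K))
      where
      K≤H : count r K ≤ count r H
      K≤H = *-cancelˡ-≤ p (≤-trans
        (proper-subgroup-bound {k = r} K-subgroup (whole-subgroup r) (⊆-intro (λ _ → refl)) refl σ∈K (count-whole r))
        (≤-reflexive (sym (trans (cong (p *_) (sym (card≡count r H))) H-index))))

module Hyperplanes (p : ℕ) {{_ : NonZero p}} (p-prime : Prime p) where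

  open ≡ using (refl; sym; trans; cong; cong₂)

  open PrimeField p
  open Vectors p
  open Counting p

  _≟V_ : ∀ {r} (u v : V r) → Dec (u ≡ v)
  _≟V_ = Vec.≡-dec _≟F_

  -- one point on each line through the origin: the vectors whose first nonzero coordinate is 𝟙
  ℙ : ∀ r → List (V r)
  ℙ zero    = []
  ℙ (suc r) = map (𝟙 ∷_) (allG p r) ++ map (𝟘 ∷_) (ℙ r)

  #ℙ : ℕ → ℕ
  #ℙ r = length (ℙ r)

  #ℙ-suc : ∀ r → #ℙ (suc r) ≡ p ^ r + #ℙ r
  #ℙ-suc r = trans (length-++ (map (𝟙 ∷_) (allG p r)))
                   (cong₂ _+_ (trans (length-map _ (allG p r)) (length-allG r)) (length-map _ (ℙ r)))

  ℙ-unique : ∀ r → Unique (ℙ r)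
  ℙ-unique zero    = []
  ℙ-unique (suc r) = Unique.++⁺ (Unique.map⁺ ∷-injectiveʳ (allG-unique r)) (Unique.map⁺ ∷-injectiveʳ (ℙ-unique r))
                                leading-coordinates-differ
    where
    leading-coordinates-differ : ∀ {v} → ¬ (v ∈ map (𝟙 ∷_) (allG p r) × v ∈ map (𝟘 ∷_) (ℙ r))
    leading-coordinates-differ (v∈₁ , v∈₀) with ∈-map⁻ _ v∈₁ | ∈-map⁻ _ v∈₀
    ... | _ , _ , refl | _ , _ , 𝟙∷≡𝟘∷ = 𝟙≢𝟘 p-prime (∷-injectiveˡ 𝟙∷≡𝟘∷)

  data ℙ-View {r} : V (suc r) → Set where
    leading-𝟙 : ∀ a → ℙ-View (𝟙 ∷ a)
    leading-𝟘 : ∀ {a} → a ∈ ℙ r → ℙ-View (𝟘 ∷ a)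

  ℙ-view : ∀ {r} {a : V (suc r)} → a ∈ ℙ (suc r) → ℙ-View a
  ℙ-view {r} a∈ℙ with ∈-++⁻ (map (𝟙 ∷_) (allG p r)) a∈ℙ
  ... | inj₁ a∈₁ with ∈-map⁻ _ a∈₁
  ...   | a′ , _ , refl = leading-𝟙 a′
  ℙ-view {r} a∈ℙ | inj₂ a∈₀ with ∈-map⁻ _ a∈₀
  ...   | a′ , a′∈ℙ , refl = leading-𝟘 a′∈ℙ

  ℙ-dual : ∀ {r} {a : V r} → a ∈ ℙ r → ∃ λ v → dot a v ≡ 𝟙
  ℙ-dual {suc r} a∈ℙ with ℙ-view a∈ℙ
  ... | leading-𝟙 a′ = 𝟙 ∷ 0V r , trans (cong₂ _⊕_ (𝔽.*-identityˡ 𝟙) (dot-zeroʳ a′)) (𝔽.+-identityʳ 𝟙)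
  ... | leading-𝟘 {a′} a′∈ℙ with ℙ-dual a′∈ℙ
  ...   | v , a′·v≡𝟙 = 𝟘 ∷ v , trans (cong (_⊕ dot a′ v) (𝔽.zeroˡ 𝟘)) (trans (𝔽.+-identityˡ (dot a′ v)) a′·v≡𝟙)

  ℙ-nonzero : ∀ {r} {a : V r} → a ∈ ℙ r → a ≢ 0V r
  ℙ-nonzero a∈ℙ refl with ℙ-dual a∈ℙ
  ... | v , 0·v≡𝟙 = 𝟙≢𝟘 p-prime (trans (sym 0·v≡𝟙) (dot-zeroˡ v))

  ker : ∀ {r} → V r → Subset p r
  ker a τ = does (dot a τ ≟F 𝟘)

  ∈ker⁺ : ∀ {r} (a τ : V r) → dot a τ ≡ 𝟘 → ker a τ ≡ true
  ∈ker⁺ a τ = dec-true (dot a τ ≟F 𝟘)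

  ∈ker⁻ : ∀ {r} (a τ : V r) → ker a τ ≡ true → dot a τ ≡ 𝟘
  ∈ker⁻ a τ = dec-true⁻¹ (dot a τ ≟F 𝟘)

  ker-subgroup : ∀ {r} (a : V r) → IsSubgroup p r (ker a)
  ker-subgroup {r} a = ∈ker⁺ a (0V r) (dot-zeroʳ a) , closed-+ , closed-neg
    where
    closed-+ : ∀ u v → ker a u ≡ true → ker a v ≡ true → ker a (u +V v) ≡ true
    closed-+ u v u∈ v∈ = ∈ker⁺ a (u +V v) (begin
      dot a (u +V v)      ≡⟨ dot-distribˡ a u v ⟩
      dot a u ⊕ dot a v   ≡⟨ cong₂ _⊕_ (∈ker⁻ a u u∈) (∈ker⁻ a v v∈) ⟩
      𝟘 ⊕ 𝟘               ≡⟨ 𝔽.+-identityˡ 𝟘 ⟩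
      𝟘                   ∎)
      where open ≡-Reasoning
    closed-neg : ∀ u → ker a u ≡ true → ker a (-V u) ≡ true
    closed-neg u u∈ = ∈ker⁺ a (-V u) (trans (dot-negʳ a u) (trans (cong ⊖_ (∈ker⁻ a u u∈)) 𝔽.-0#≈0#))

  count-dot≡ : ∀ {r} {τ : V r} → τ ≢ 0V r → ∀ s → p * count r (λ a → does (dot a τ ≟F s)) ≡ p ^ r
  count-affine : ∀ {r} {τ : V r} → τ ≢ 0V r → ∀ c s → p * count r (λ a → does (c ⊕ dot a τ ≟F s)) ≡ p ^ r

  count-affine {r} {τ} τ≢0 c s = trans (cong (p *_) (count-cong translated)) (count-dot≡ τ≢0 (⊖ c ⊕ s))
    where
    translated : ∀ a → does (c ⊕ dot a τ ≟F s) ≡ does (dot a τ ≟F ⊖ c ⊕ s)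
    translated a = does-⇔ (c ⊕ dot a τ ≟F s) (dot a τ ≟F ⊖ c ⊕ s)
                          (⊕-solveʳ c (dot a τ) s) (⊕-solveʳ⁻¹ c (dot a τ) s)

  count-dot≡ {zero}  {[]}    []≢0 s = contradiction refl []≢0
  count-dot≡ {suc r} {t ∷ τ} t∷τ≢0 s with τ ≟V 0V r
  ... | no τ≢0 = begin
    p * count (suc r) (λ a → does (dot a (t ∷ τ) ≟F s))
      ≡⟨ cong (p *_) (count-∷ r _) ⟩
    p * (∑ℕ[ x ∈ allFin p ] count r (λ v → does (x ⊛ t ⊕ dot v τ ≟F s)))
      ≡⟨ ∑ℕ-*ˡ (allFin p) p _ ⟨
    ∑ℕ[ x ∈ allFin p ] p * count r (λ v → does (x ⊛ t ⊕ dot v τ ≟F s))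
      ≡⟨ ℕ∑.∑-cong (allFin p) (λ x → count-affine τ≢0 (x ⊛ t) s) ⟩
    ∑ℕ[ x ∈ allFin p ] p ^ r
      ≡⟨ ∑ℕ-allFin-const (p ^ r) ⟩
    p * p ^ r ∎
    where open ≡-Reasoning
  ... | yes refl = begin
    p * count (suc r) (λ a → does (dot a (t ∷ 0V r) ≟F s))
      ≡⟨ cong (p *_) (count-∷ r _) ⟩
    p * (∑ℕ[ x ∈ allFin p ] count r (λ v → does (x ⊛ t ⊕ dot v (0V r) ≟F s)))
      ≡⟨ cong (p *_) (ℕ∑.∑-cong (allFin p) (λ x → trans (count-cong (constant x)) (count-const r _))) ⟩
    p * (∑ℕ[ x ∈ allFin p ] p ^ r * χ (does (x ⊛ t ≟F s)))
      ≡⟨ cong (p *_) (∑ℕ-*ˡ (allFin p) (p ^ r) _) ⟩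
    p * (p ^ r * (∑ℕ[ x ∈ allFin p ] χ (does (x ⊛ t ≟F s))))
      ≡⟨ cong (λ n → p * (p ^ r * n)) unique-solution ⟩
    p * (p ^ r * 1)
      ≡⟨ cong (p *_) (*-identityʳ (p ^ r)) ⟩
    p * p ^ r ∎
    where
    open ≡-Reasoning
    constant : ∀ x v → does (x ⊛ t ⊕ dot v (0V r) ≟F s) ≡ does (x ⊛ t ≟F s)
    constant x v = cong (λ y → does (y ≟F s)) (trans (cong (x ⊛ t ⊕_) (dot-zeroʳ v)) (𝔽.+-identityʳ (x ⊛ t)))
    t≢𝟘 : t ≢ 𝟘
    t≢𝟘 refl = t∷τ≢0 refl
    unique-solution : ∑ℕ[ x ∈ allFin p ] χ (does (x ⊛ t ≟F s)) ≡ 1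
    unique-solution with ⊛-inverse p-prime t t≢𝟘
    ... | u , u*t≡𝟙 = trans
      (ℕ∑.∑-cong (allFin p) (λ x → cong χ (does-⇔ (x ⊛ t ≟F s) (x ≟F s ⊛ u)
                                                   (⊛-solveʳ u*t≡𝟙 x s) (⊛-solveʳ⁻¹ u*t≡𝟙 x s))))
      (ℕ∑.∑-δ _≟F_ (Unique.allFin⁺ p) (∈-allFin (s ⊛ u)) 1)

  count-ker : ∀ {r} {a : V (suc r)} → a ∈ ℙ (suc r) → count (suc r) (ker a) ≡ p ^ r
  count-ker {r} {a} a∈ℙ = *-cancelˡ-≡ _ _ p (trans
    (cong (p *_) (count-cong (λ τ → cong (λ y → does (y ≟F 𝟘)) (dot-comm a τ))))
    (count-dot≡ (ℙ-nonzero a∈ℙ) 𝟘))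

  δ₀ : ∀ {r} → V r → ℕ → ℕ
  δ₀ τ n = if does (τ ≟V 0V _) then n else 0

  ∑-ℙ-suc : ∀ r (f : V (suc r) → ℕ) →
            ∑ℕ (ℙ (suc r)) f ≡ (∑ℕ[ a ∈ allG p r ] f (𝟙 ∷ a)) + (∑ℕ[ a ∈ ℙ r ] f (𝟘 ∷ a))
  ∑-ℙ-suc r f = trans (ℕ∑.∑-++ (map (𝟙 ∷_) (allG p r)) _ f)
                      (cong₂ _+_ (ℕ∑.∑-map (allG p r) (𝟙 ∷_) f) (ℕ∑.∑-map (ℙ r) (𝟘 ∷_) f))

  dot-𝟘∷ : ∀ {r} x (a τ : V r) → dot (𝟘 ∷ a) (x ∷ τ) ≡ dot a τ
  dot-𝟘∷ x a τ = trans (cong (_⊕ dot a τ) (𝔽.zeroˡ x)) (𝔽.+-identityˡ (dot a τ))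

  #hyperplanes∋0 : ∀ r → ∑ℕ[ a ∈ ℙ r ] χ (ker a (0V r)) ≡ #ℙ r
  #hyperplanes∋0 r = trans (ℕ∑.∑-cong (ℙ r) (λ a → cong χ (∈ker⁺ a (0V r) (dot-zeroʳ a))))
                           (trans (∑ℕ-const (ℙ r) 1) (*-identityʳ (#ℙ r)))

  #hyperplanes∋-∷ : ∀ r t (τ : V r) → ∑ℕ[ a ∈ ℙ (suc r) ] χ (ker a (t ∷ τ))
                                      ≡ count r (λ a → does (𝟙 ⊛ t ⊕ dot a τ ≟F 𝟘)) + (∑ℕ[ a ∈ ℙ r ] χ (ker a τ))
  #hyperplanes∋-∷ r t τ = trans (∑-ℙ-suc r _) (cong (count r (λ a → does (𝟙 ⊛ t ⊕ dot a τ ≟F 𝟘)) +_)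
    (ℕ∑.∑-cong (ℙ r) (λ a → cong (λ y → χ (does (y ≟F 𝟘))) (dot-𝟘∷ t a τ))))

  #hyperplanes∋≢0 : ∀ r {τ : V (suc r)} → τ ≢ 0V (suc r) → ∑ℕ[ a ∈ ℙ (suc r) ] χ (ker a τ) ≡ #ℙ r
  #hyperplanes∋≢0 r {t ∷ τ} t∷τ≢0 with τ ≟V 0V r
  ... | yes refl = trans (#hyperplanes∋-∷ r t (0V r)) (cong₂ _+_ (count-∅ none) (#hyperplanes∋0 r))
    where
    none : ∀ a → does (𝟙 ⊛ t ⊕ dot a (0V r) ≟F 𝟘) ≡ false
    none a = dec-false (𝟙 ⊛ t ⊕ dot a (0V r) ≟F 𝟘) (λ 𝟙t+a·0≡𝟘 → t∷τ≢0 (cong (_∷ 0V r)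
      (trans (sym (trans (cong₂ _⊕_ (𝔽.*-identityˡ t) (dot-zeroʳ a)) (𝔽.+-identityʳ t))) 𝟙t+a·0≡𝟘)))
  #hyperplanes∋≢0 zero    {t ∷ []} _ | no []≢0 = contradiction refl []≢0
  #hyperplanes∋≢0 (suc r) {t ∷ τ}  _ | no τ≢0  = begin
    ∑ℕ[ a ∈ ℙ (suc (suc r)) ] χ (ker a (t ∷ τ))
      ≡⟨ #hyperplanes∋-∷ (suc r) t τ ⟩
    count (suc r) (λ a → does (𝟙 ⊛ t ⊕ dot a τ ≟F 𝟘)) + (∑ℕ[ a ∈ ℙ (suc r) ] χ (ker a τ))
      ≡⟨ cong₂ _+_ (*-cancelˡ-≡ _ _ p (count-affine τ≢0 (𝟙 ⊛ t) 𝟘)) (#hyperplanes∋≢0 r τ≢0) ⟩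
    p ^ r + #ℙ r
      ≡⟨ #ℙ-suc r ⟨
    #ℙ (suc r) ∎
    where open ≡-Reasoning

  #hyperplanes∋ : ∀ r (τ : V (suc r)) → ∑ℕ[ a ∈ ℙ (suc r) ] χ (ker a τ) ≡ #ℙ r + δ₀ τ (p ^ r)
  #hyperplanes∋ r τ with τ ≟V 0V (suc r)
  ... | yes refl = trans (#hyperplanes∋0 (suc r)) (trans (#ℙ-suc r) (+-comm (p ^ r) (#ℙ r)))
  ... | no  τ≢0  = trans (#hyperplanes∋≢0 r τ≢0) (sym (+-identityʳ (#ℙ r)))

  dot-ext : ∀ {r} (a b : V r) → (∀ v → dot a v ≡ dot b v) → a ≡ b
  dot-ext []      []      _     = refl
  dot-ext {suc r} (x ∷ a) (y ∷ b) a·≗b· = cong₂ _∷_ x≡y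
    (dot-ext a b (λ v → trans (sym (dot-∷𝟘 x a v)) (trans (a·≗b· (𝟘 ∷ v)) (dot-∷𝟘 y b v))))
    where
    dot-∷𝟘 : ∀ z (c v : V r) → dot (z ∷ c) (𝟘 ∷ v) ≡ dot c v
    dot-∷𝟘 z c v = trans (cong (_⊕ dot c v) (𝔽.zeroʳ z)) (𝔽.+-identityˡ (dot c v))
    first : ∀ z (c : V r) → dot (z ∷ c) (𝟙 ∷ 0V r) ≡ z
    first z c = trans (cong₂ _⊕_ (𝔽.*-identityʳ z) (dot-zeroʳ c)) (𝔽.+-identityʳ z)
    x≡y : x ≡ y
    x≡y = trans (sym (first x a)) (trans (a·≗b· (𝟙 ∷ 0V r)) (first y b))

  ker⊆⇒dot≡𝟘 : ∀ {r} (a b : V r) → ker a ⊆ ker b → ∀ τ → dot a τ ≡ 𝟘 → dot b τ ≡ 𝟘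
  ker⊆⇒dot≡𝟘 a b ker-a⊆ker-b τ a·τ≡𝟘 = ∈ker⁻ b τ (⊆-elim ker-a⊆ker-b (∈ker⁺ a τ a·τ≡𝟘))

  lift : ∀ {r} → V r → V r → V (suc r)
  lift a v = ⊖ dot a v ∷ v

  lift∈ker : ∀ {r} (a v : V r) → dot (𝟙 ∷ a) (lift a v) ≡ 𝟘
  lift∈ker a v = trans (cong (_⊕ dot a v) (𝔽.*-identityˡ _)) (𝔽.-‿inverseˡ (dot a v))

  ker⊆ker⇒≡ : ∀ {r} {a b : V r} → a ∈ ℙ r → b ∈ ℙ r → ker a ⊆ ker b → a ≡ b
  ker⊆ker⇒≡ {suc r} a∈ℙ b∈ℙ ker⊆ with ℙ-view a∈ℙ | ℙ-view b∈ℙ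
  ... | leading-𝟙 a | leading-𝟙 b = cong (𝟙 ∷_) (dot-ext a b (λ v → sym (begin
    dot b v          ≡⟨ 𝔽.+-inverseʳ-unique (⊖ dot a v) (dot b v) (trans
                          (cong (_⊕ dot b v) (sym (𝔽.*-identityˡ _))) (ker⊆⇒dot≡𝟘 (𝟙 ∷ a) (𝟙 ∷ b) ker⊆ (lift a v) (lift∈ker a v))) ⟩
    ⊖ ⊖ dot a v      ≡⟨ 𝔽.-‿involutive (dot a v) ⟩
    dot a v          ∎)))
    where open ≡-Reasoning
  ... | leading-𝟙 a | leading-𝟘 {b} b∈ℙ′ =
    let v , b·v≡𝟙 = ℙ-dual b∈ℙ′ in
    contradiction (trans (sym b·v≡𝟙) (trans (sym (dot-𝟘∷ _ b v))
                                             (ker⊆⇒dot≡𝟘 (𝟙 ∷ a) (𝟘 ∷ b) ker⊆ (lift a v) (lift∈ker a v))))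
                  (𝟙≢𝟘 p-prime)
  ... | leading-𝟘 {a} _ | leading-𝟙 b =
    contradiction (trans (sym 𝟙·e₀≡𝟙)
                         (ker⊆⇒dot≡𝟘 (𝟘 ∷ a) (𝟙 ∷ b) ker⊆ (𝟙 ∷ 0V r) (trans (dot-𝟘∷ 𝟙 a (0V r)) (dot-zeroʳ a))))
                  (𝟙≢𝟘 p-prime)
    where
    𝟙·e₀≡𝟙 : dot (𝟙 ∷ b) (𝟙 ∷ 0V r) ≡ 𝟙
    𝟙·e₀≡𝟙 = trans (cong₂ _⊕_ (𝔽.*-identityˡ 𝟙) (dot-zeroʳ b)) (𝔽.+-identityʳ 𝟙)
  ... | leading-𝟘 {a} a∈ℙ′ | leading-𝟘 {b} b∈ℙ′ = cong (𝟘 ∷_) (ker⊆ker⇒≡ a∈ℙ′ b∈ℙ′ (⊆-intro λ {τ} τ∈ker-a →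
    ∈ker⁺ b τ (trans (sym (dot-𝟘∷ 𝟘 b τ))
                     (ker⊆⇒dot≡𝟘 (𝟘 ∷ a) (𝟘 ∷ b) ker⊆ (𝟘 ∷ τ) (trans (dot-𝟘∷ 𝟘 a τ) (∈ker⁻ a τ τ∈ker-a))))))

  #ℙ-geometric : ∀ r → p * #ℙ r + 1 ≡ #ℙ r + p ^ r
  #ℙ-geometric zero    = cong (_+ 1) (*-zeroʳ p)
  #ℙ-geometric (suc r) = begin
    p * #ℙ (suc r) + 1          ≡⟨ cong (λ n → p * n + 1) (#ℙ-suc r) ⟩
    p * (p ^ r + #ℙ r) + 1      ≡⟨ geometric-step p (p ^ r) (#ℙ r) (#ℙ-geometric r) ⟩
    p ^ r + #ℙ r + p * p ^ r    ≡⟨ cong (_+ p ^ suc r) (#ℙ-suc r) ⟨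
    #ℙ (suc r) + p ^ suc r      ∎
    where open ≡-Reasoning

  ∑-count-∩ker : ∀ r (H : Subset p (suc r)) → ∑ℕ[ a ∈ ℙ (suc r) ] count (suc r) (H ∩ ker a)
                                              ≡ ∑ℕ[ τ ∈ allG p (suc r) ] χ (H τ) * (#ℙ r + δ₀ τ (p ^ r))
  ∑-count-∩ker r H = begin
    ∑ℕ[ a ∈ ℙ (suc r) ] ∑ℕ[ τ ∈ allG p (suc r) ] χ (H τ ∧ ker a τ)
      ≡⟨ ℕ∑.∑-comm (ℙ (suc r)) (allG p (suc r)) _ ⟩
    ∑ℕ[ τ ∈ allG p (suc r) ] ∑ℕ[ a ∈ ℙ (suc r) ] χ (H τ ∧ ker a τ)
      ≡⟨ ℕ∑.∑-cong (allG p (suc r)) (λ τ → begin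
           ∑ℕ[ a ∈ ℙ (suc r) ] χ (H τ ∧ ker a τ)    ≡⟨ ℕ∑.∑-cong (ℙ (suc r)) (λ a → χ-∧ (H τ) (ker a τ)) ⟩
           ∑ℕ[ a ∈ ℙ (suc r) ] χ (H τ) * χ (ker a τ) ≡⟨ ∑ℕ-*ˡ (ℙ (suc r)) (χ (H τ)) _ ⟩
           χ (H τ) * (∑ℕ[ a ∈ ℙ (suc r) ] χ (ker a τ)) ≡⟨ cong (χ (H τ) *_) (#hyperplanes∋ r τ) ⟩
           χ (H τ) * (#ℙ r + δ₀ τ (p ^ r))          ∎) ⟩
    ∑ℕ[ τ ∈ allG p (suc r) ] χ (H τ) * (#ℙ r + δ₀ τ (p ^ r)) ∎
    where open ≡-Reasoning

  module _ {r} {H : Subset p (suc r)} (H-subgroup : IsSubgroup p (suc r) H) (H-index : HasIndexP p (suc r) H) where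

    count-index-p : count (suc r) H ≡ p ^ r
    count-index-p = *-cancelˡ-≡ _ _ p (trans (cong (p *_) (sym (card≡count (suc r) H))) H-index)

    ∑-count-∩ker-≥ : p ^ r * #ℙ r + p ^ r ≤ ∑ℕ[ a ∈ ℙ (suc r) ] count (suc r) (H ∩ ker a)
    ∑-count-∩ker-≥ = begin
      p ^ r * #ℙ r + p ^ r
        ≡⟨ cong₂ _+_ (cong (_* #ℙ r) (sym count-index-p)) (sym origin-term) ⟩
      count (suc r) H * #ℙ r + χ (H (0V (suc r))) * δ₀ (0V (suc r)) (p ^ r)
        ≤⟨ +-monoʳ-≤ _ (∑ℕ-≥-term (allG p (suc r)) (λ τ → χ (H τ) * δ₀ τ (p ^ r)) (∈-allG (0V (suc r)))) ⟩
      count (suc r) H * #ℙ r + (∑ℕ[ τ ∈ allG p (suc r) ] χ (H τ) * δ₀ τ (p ^ r))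
        ≡⟨ cong (_+ (∑ℕ[ τ ∈ allG p (suc r) ] χ (H τ) * δ₀ τ (p ^ r)))
                (∑ℕ-*ʳ (allG p (suc r)) (#ℙ r) (λ τ → χ (H τ))) ⟨
      (∑ℕ[ τ ∈ allG p (suc r) ] χ (H τ) * #ℙ r) + (∑ℕ[ τ ∈ allG p (suc r) ] χ (H τ) * δ₀ τ (p ^ r))
        ≡⟨ ℕ∑.∑-distrib-∙ (allG p (suc r)) _ _ ⟨
      ∑ℕ[ τ ∈ allG p (suc r) ] (χ (H τ) * #ℙ r + χ (H τ) * δ₀ τ (p ^ r))
        ≡⟨ ℕ∑.∑-cong (allG p (suc r)) (λ τ → *-distribˡ-+ (χ (H τ)) (#ℙ r) _) ⟨
      ∑ℕ[ τ ∈ allG p (suc r) ] χ (H τ) * (#ℙ r + δ₀ τ (p ^ r))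
        ≡⟨ ∑-count-∩ker r H ⟨
      ∑ℕ[ a ∈ ℙ (suc r) ] count (suc r) (H ∩ ker a) ∎
      where
      open ≤-Reasoning
      origin-term : χ (H (0V (suc r))) * δ₀ (0V (suc r)) (p ^ r) ≡ p ^ r
      origin-term rewrite proj₁ H-subgroup | dec-true (0V (suc r) ≟V 0V (suc r)) refl = +-identityʳ (p ^ r)

    ∑-count-∩ker-≤ : (∀ {a} → a ∈ ℙ (suc r) → ¬ H ⊆ ker a) →
                     p * (∑ℕ[ a ∈ ℙ (suc r) ] count (suc r) (H ∩ ker a)) ≤ (p ^ r + #ℙ r) * p ^ r
    ∑-count-∩ker-≤ H⊈ker = begin
      p * (∑ℕ[ a ∈ ℙ (suc r) ] count (suc r) (H ∩ ker a)) ≡⟨ ∑ℕ-*ˡ (ℙ (suc r)) p _ ⟨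
      ∑ℕ[ a ∈ ℙ (suc r) ] p * count (suc r) (H ∩ ker a)   ≤⟨ ∑ℕ-mono-≤ (ℙ (suc r)) proper ⟩
      ∑ℕ[ a ∈ ℙ (suc r) ] p ^ r                           ≡⟨ ∑ℕ-const (ℙ (suc r)) (p ^ r) ⟩
      #ℙ (suc r) * p ^ r                                  ≡⟨ cong (_* p ^ r) (#ℙ-suc r) ⟩
      (p ^ r + #ℙ r) * p ^ r                              ∎
      where
      open ≤-Reasoning
      proper : ∀ {a} → a ∈ ℙ (suc r) → p * count (suc r) (H ∩ ker a) ≤ p ^ r
      proper {a} a∈ℙ with ⊆-or-witness H (ker a)
      ... | inj₁ H⊆ker-a             = contradiction H⊆ker-a (H⊈ker a∈ℙ)
      ... | inj₂ (τ , τ∈H , τ∉ker-a) =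
        proper-subgroup-bound p-prime {k = r} (∩-subgroup H-subgroup (ker-subgroup a)) H-subgroup ∩⊆ˡ
                              τ∈H (cong₂ _∧_ τ∈H τ∉ker-a) count-index-p

    index-p⇒hyperplane : ∃ λ a → a ∈ ℙ (suc r) × SameSubset p (suc r) H (ker a)
    index-p⇒hyperplane with any? (λ a → H ⊆? ker a) (ℙ (suc r))
    ... | yes some = let a , a∈ℙ , H⊆ker-a = find some in
      a , a∈ℙ , ⊆-antisym H⊆ker-a (⊆∧count≤⇒⊇ H⊆ker-a (≤-reflexive (trans (count-ker a∈ℙ) (sym count-index-p))))
    ... | no  none = contradiction
      (≤-trans (*-monoʳ-≤ p ∑-count-∩ker-≥) (∑-count-∩ker-≤ (λ a∈ℙ H⊆ker-a → none (lose a∈ℙ H⊆ker-a))))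
      (<⇒≱ ([P+Q]*P<p*[P*Q+P] (nonTrivial⇒n>1 p {{prime⇒nonTrivial p-prime}}) (m^n>0 p r) (#ℙ-geometric r)))

module ModuleTheory {c ℓ : Level} (p : ℕ) {{_ : NonZero p}} (r : ℕ) (M : GModule p r c ℓ) where

  open Vectors p
  open Counting p
  open GModule M
  open AbelianGroupProperties grp using (inverseʳ-unique; identityˡ-unique)
  open ListSum commutativeMonoid public
  open MonoidMult monoid public using () renaming (_×_ to _·_; ×-congʳ to ·-congʳ; ×-homo-+ to ·-homo-+)
  open CommutativeMonoidMult commutativeMonoid public using () renaming (×-distrib-+ to ·-distrib-∙)
  open import Relation.Binary.Reasoning.Setoid setoid

  times≡· : ∀ d x → times p r M d x ≡ d · x
  times≡· zero    x = ≡.refl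
  times≡· (suc d) x = ≡.cong (x ∙_) (times≡· d x)

  sumList-map : ∀ {a} {A : Set a} (xs : List A) f → sumList p r M (map f xs) ≡ ∑ xs f
  sumList-map []       f = ≡.refl
  sumList-map (x ∷ xs) f = ≡.cong (f x ∙_) (sumList-map xs f)

  sumFin≈∑ : ∀ N f → sumFin p r M N f ≈ ∑ (allFin N) f
  sumFin≈∑ zero    f = refl
  sumFin≈∑ (suc N) f = ∙-congˡ (begin
    sumFin p r M N (f ∘ suc)         ≈⟨ sumFin≈∑ N (f ∘ suc) ⟩
    ∑ (allFin N) (f ∘ suc)           ≡⟨ ∑-map (allFin N) suc f ⟨
    ∑ (map suc (allFin N)) f         ≡⟨ ≡.cong (λ xs → ∑ xs f) (map-tabulate (λ i → i) suc) ⟩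
    ∑ (tabulate suc) f               ∎)

  ·-ε : ∀ d → d · ε ≈ ε
  ·-ε zero    = refl
  ·-ε (suc d) = trans (identityˡ _) (·-ε d)

  ·-∑ : ∀ d {a} {A : Set a} (xs : List A) f → d · ∑ xs f ≈ ∑[ y ∈ xs ] d · f y
  ·-∑ d = ∑-homo (d ·_) (·-congʳ d) (·-ε d) (λ x y → ·-distrib-∙ x y d)

  ∑-· : ∀ {a} {A : Set a} (xs : List A) (f : A → ℕ) x → ∑[ y ∈ xs ] f y · x ≈ ∑ℕ xs f · x
  ∑-· []       f x = refl
  ∑-· (y ∷ xs) f x = trans (∙-congˡ (∑-· xs f x)) (sym (·-homo-+ x (f y) (∑ℕ xs f)))

  if-ε≈χ· : ∀ b x → (if b then x else ε) ≈ χ b · x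
  if-ε≈χ· true  x = sym (identityʳ x)
  if-ε≈χ· false x = refl

  act-ε : ∀ g → act g ε ≈ ε
  act-ε g = identityˡ-unique (act g ε) (act g ε) (trans (sym (act-∙ g ε ε)) (act-cong g (identityˡ ε)))

  act-⁻¹ : ∀ g x → act g (x ⁻¹) ≈ act g x ⁻¹
  act-⁻¹ g x = inverseʳ-unique (act g x) (act g (x ⁻¹))
    (trans (sym (act-∙ g x (x ⁻¹))) (trans (act-cong g (inverseʳ x)) (act-ε g)))

  act-comm : ∀ g h x → act g (act h x) ≈ act h (act g x)
  act-comm g h x = trans (sym (act-+ g h x)) (trans (reflexive (≡.cong (λ σ → act σ x) (𝕍.comm g h))) (act-+ h g x))

  act-· : ∀ g d x → act g (d · x) ≈ d · act g x
  act-· g zero    x = act-ε g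
  act-· g (suc d) x = trans (act-∙ g x (d · x)) (∙-congˡ (act-· g d x))

  act-∑ : ∀ g {a} {A : Set a} (xs : List A) f → act g (∑ xs f) ≈ ∑[ y ∈ xs ] act g (f y)
  act-∑ g = ∑-homo (act g) (act-cong g) (act-ε g) (act-∙ g)

  module _ (H : Subset p r) where

    Fixed-resp : ∀ {x y} → x ≈ y → Fixed p r M H y → Fixed p r M H x
    Fixed-resp x≈y y-fixed σ σ∈H = trans (act-cong σ x≈y) (trans (y-fixed σ σ∈H) (sym x≈y))

    Fixed-⁻¹ : ∀ {x} → Fixed p r M H x → Fixed p r M H (x ⁻¹)
    Fixed-⁻¹ {x} x-fixed σ σ∈H = trans (act-⁻¹ σ x) (⁻¹-cong (x-fixed σ σ∈H))

    Fixed-ε : Fixed p r M H ε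
    Fixed-ε σ _ = act-ε σ

    Fixed-∑ : ∀ {a} {A : Set a} (xs : List A) f → (∀ y → Fixed p r M H (f y)) → Fixed p r M H (∑ xs f)
    Fixed-∑ xs f f-fixed σ σ∈H = trans (act-∑ σ xs f) (∑-cong xs (λ y → f-fixed y σ σ∈H))

  module Division {n} (inv : ℕ → Carrier → Carrier) (inv-spec : IsInverseOfMult p r M n inv) {d} (d⊥n : Coprime d n) where

    inv-cong : ∀ {x y} → x ≈ y → inv d x ≈ inv d y
    inv-cong = proj₁ (inv-spec d d⊥n)

    ·-inv : ∀ x → d · inv d x ≈ x
    ·-inv x = trans (reflexive (≡.sym (times≡· d (inv d x)))) (proj₁ (proj₂ (inv-spec d d⊥n)) x)

    inv-· : ∀ x → inv d (d · x) ≈ x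
    inv-· x = trans (inv-cong (reflexive (≡.sym (times≡· d x)))) (proj₂ (proj₂ (inv-spec d d⊥n)) x)

    inv-∙ : ∀ x y → inv d (x ∙ y) ≈ inv d x ∙ inv d y
    inv-∙ x y = trans (inv-cong (trans (∙-cong (sym (·-inv x)) (sym (·-inv y))) (sym (·-distrib-∙ _ _ d)))) (inv-· _)

    inv-ε : inv d ε ≈ ε
    inv-ε = trans (inv-cong (sym (·-ε d))) (inv-· ε)

    inv-act : ∀ g x → act g (inv d x) ≈ inv d (act g x)
    inv-act g x = trans (sym (inv-· _)) (inv-cong (trans (sym (act-· g d (inv d x))) (act-cong g (·-inv x))))

    inv-∑ : ∀ {a} {A : Set a} (xs : List A) f → inv d (∑ xs f) ≈ ∑[ y ∈ xs ] inv d (f y)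
    inv-∑ = ∑-homo (inv d) inv-cong inv-ε inv-∙

  ∑-translate : ∀ (σ : V r) (F : V r → Carrier) → ∑[ τ ∈ allG p r ] F (σ +V τ) ≈ ∑ (allG p r) F
  ∑-translate σ F = trans (reflexive (≡.sym (∑-map (allG p r) (σ +V_) F))) (∑-↭ F (allG-translate σ))

  Nm : Subset p r → Carrier → Carrier
  Nm H m = ∑[ τ ∈ allG p r ] χ (H τ) · act τ m

  Nm-cong : ∀ H {x y} → x ≈ y → Nm H x ≈ Nm H y
  Nm-cong H x≈y = ∑-cong (allG p r) (λ τ → ·-congʳ (χ (H τ)) (act-cong τ x≈y))

  Nm-∙ : ∀ H x y → Nm H (x ∙ y) ≈ Nm H x ∙ Nm H y
  Nm-∙ H x y = trans (∑-cong (allG p r) (λ τ → trans (·-congʳ (χ (H τ)) (act-∙ τ x y)) (·-distrib-∙ _ _ (χ (H τ)))))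
                     (∑-distrib-∙ (allG p r) _ _)

  Nm-ε : ∀ H → Nm H ε ≈ ε
  Nm-ε H = trans (∑-cong (allG p r) (λ τ → trans (·-congʳ (χ (H τ)) (act-ε τ)) (·-ε (χ (H τ))))) (∑-ε (allG p r))

  act-Nm : ∀ H g m → act g (Nm H m) ≈ Nm H (act g m)
  act-Nm H g m = trans (act-∑ g (allG p r) _)
    (∑-cong (allG p r) (λ τ → trans (act-· g (χ (H τ)) (act τ m)) (·-congʳ (χ (H τ)) (act-comm g τ m))))

  Nm-fixed : ∀ {H} → IsSubgroup p r H → ∀ m → Fixed p r M H (Nm H m)
  Nm-fixed {H} (_ , H-+ , H-neg) m σ σ∈H = begin
    act σ (Nm H m)                                        ≈⟨ act-∑ σ (allG p r) _ ⟩
    ∑[ τ ∈ allG p r ] act σ (χ (H τ) · act τ m)           ≈⟨ ∑-cong (allG p r) shift ⟩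
    ∑[ τ ∈ allG p r ] χ (H (σ +V τ)) · act (σ +V τ) m     ≈⟨ ∑-translate σ (λ τ → χ (H τ) · act τ m) ⟩
    Nm H m                                                ∎
    where
    H-shift : ∀ τ → H (σ +V τ) ≡ H τ
    H-shift τ = ⊆-antisym {S = λ τ → H (σ +V τ)} {T = H}
      (⊆-intro λ {τ} σ+τ∈H →
        ≡.subst (λ x → H x ≡ true) (𝕍.\\-leftDividesʳ σ τ) (H-+ (-V σ) (σ +V τ) (H-neg σ σ∈H) σ+τ∈H))
      (⊆-intro λ {τ} τ∈H → H-+ σ τ σ∈H τ∈H) τ
    shift : ∀ τ → act σ (χ (H τ) · act τ m) ≈ χ (H (σ +V τ)) · act (σ +V τ) m
    shift τ = trans (act-· σ (χ (H τ)) (act τ m))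
                    (trans (reflexive (≡.cong (_· act σ (act τ m)) (≡.sym (≡.cong χ (H-shift τ)))))
                           (·-congʳ (χ (H (σ +V τ))) (sym (act-+ σ τ m))))

  Nm-fixed-point : ∀ H {x} → Fixed p r M H x → Nm H x ≈ count r H · x
  Nm-fixed-point H {x} x-fixed = trans (∑-cong (allG p r) on-H) (∑-· (allG p r) (λ τ → χ (H τ)) x)
    where
    on-H : ∀ τ → χ (H τ) · act τ x ≈ χ (H τ) · x
    on-H τ with H τ in τ∈?H
    ... | true  = ·-congʳ 1 (x-fixed τ τ∈?H)
    ... | false = refl

  module Averaging {n} (inv : ℕ → Carrier → Carrier) (inv-spec : IsInverseOfMult p r M n inv) (n⊥p : Coprime n p) where

    ε[_] : Subset p r → Carrier → Carrier
    ε[ H ] = epsH p r M inv H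

    card-coprime : ∀ {H} → IsSubgroup p r H → Coprime (card p r H) n
    card-coprime {H} H-subgroup =
      coprime-∣^ n⊥p r (≡.subst (_∣ p ^ r) (≡.sym (card≡count r H)) (count-subgroup-∣ H-subgroup))

    module _ {H} (H-subgroup : IsSubgroup p r H) where

      open Division inv inv-spec (card-coprime H-subgroup)

      ε≈inv-Nm : ∀ m → ε[ H ] m ≈ inv (card p r H) (Nm H m)
      ε≈inv-Nm m = inv-cong (begin
        sumList p r M (map (λ σ → act σ m) (elems p r H))  ≡⟨ sumList-map (elems p r H) (λ σ → act σ m) ⟩
        ∑ (filterᵇ H (allG p r)) (λ σ → act σ m)           ≈⟨ ∑-filterᵇ H (allG p r) (λ σ → act σ m) ⟩
        ∑[ τ ∈ allG p r ] (if H τ then act τ m else ε)     ≈⟨ ∑-cong (allG p r) (λ τ → if-ε≈χ· (H τ) (act τ m)) ⟩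
        Nm H m                                             ∎)

      ε-fixed : ∀ m → Fixed p r M H (ε[ H ] m)
      ε-fixed m = Fixed-resp H (ε≈inv-Nm m)
        (λ σ σ∈H → trans (inv-act σ (Nm H m)) (inv-cong (Nm-fixed H-subgroup m σ σ∈H)))

      ε-retract : ∀ {x} → Fixed p r M H x → ε[ H ] x ≈ x
      ε-retract {x} x-fixed = begin
        ε[ H ] x                           ≈⟨ ε≈inv-Nm x ⟩
        inv (card p r H) (Nm H x)          ≈⟨ inv-cong (Nm-fixed-point H x-fixed) ⟩
        inv (card p r H) (count r H · x)   ≡⟨ ≡.cong (λ k → inv (card p r H) (k · x)) (card≡count r H) ⟨
        inv (card p r H) (card p r H · x)  ≈⟨ inv-· x ⟩
        x                                  ∎

      ε-preserves-G-fixed : ∀ {m} → Fixed p r M (whole p r) m → Fixed p r M (whole p r) (ε[ H ] m)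
      ε-preserves-G-fixed m-fixed = Fixed-resp (whole p r) (ε-retract (λ σ _ → m-fixed σ ≡.refl)) m-fixed

      ε-cong : ∀ {x y} → x ≈ y → ε[ H ] x ≈ ε[ H ] y
      ε-cong {x} {y} x≈y = trans (ε≈inv-Nm x) (trans (inv-cong (Nm-cong H x≈y)) (sym (ε≈inv-Nm y)))

      ε-act : ∀ g m → act g (ε[ H ] m) ≈ ε[ H ] (act g m)
      ε-act g m = begin
        act g (ε[ H ] m)                   ≈⟨ act-cong g (ε≈inv-Nm m) ⟩
        act g (inv (card p r H) (Nm H m))  ≈⟨ inv-act g (Nm H m) ⟩
        inv (card p r H) (act g (Nm H m))  ≈⟨ inv-cong (act-Nm H g m) ⟩
        inv (card p r H) (Nm H (act g m))  ≈⟨ ε≈inv-Nm (act g m) ⟨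
        ε[ H ] (act g m)                   ∎

      ε-∑ : ∀ {a} {A : Set a} (xs : List A) f → ε[ H ] (∑ xs f) ≈ ∑[ y ∈ xs ] ε[ H ] (f y)
      ε-∑ = ∑-homo (ε[ H ]) ε-cong ε-ε ε-∙
        where
        ε-ε : ε[ H ] ε ≈ ε
        ε-ε = trans (ε≈inv-Nm ε) (trans (inv-cong (Nm-ε H)) inv-ε)
        ε-∙ : ∀ x y → ε[ H ] (x ∙ y) ≈ ε[ H ] x ∙ ε[ H ] y
        ε-∙ x y = trans (ε≈inv-Nm (x ∙ y)) (trans (inv-cong (Nm-∙ H x y))
                        (trans (inv-∙ (Nm H x) (Nm H y)) (sym (∙-cong (ε≈inv-Nm x) (ε≈inv-Nm y)))))

    ε-image : ∀ H → IsSubgroup p r H →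
              (∀ m → Fixed p r M H (ε[ H ] m)) × (∀ x → Fixed p r M H x → ∃ λ m → ε[ H ] m ≈ x)
    ε-image H H-subgroup = ε-fixed H-subgroup , λ x x-fixed → x , ε-retract H-subgroup x-fixed

  epsH-SameSubset : ∀ {inv H K} → SameSubset p r H K → ∀ m → epsH p r M inv H m ≡ epsH p r M inv K m
  epsH-SameSubset {inv} H≗K m =
    ≡.cong (λ L → inv (length L) (sumList p r M (map (λ σ → act σ m) L))) (filterᵇ-cong H≗K (allG p r))

module IndexPSubgroups (p : ℕ) {{_ : NonZero p}} (p-prime : Prime p) (r N : ℕ) (Gs : Fin N → Subset p (suc r))
  (Gs-index-p : ∀ i → IsSubgroup p (suc r) (Gs i) × HasIndexP p (suc r) (Gs i))
  (Gs-injective : ∀ i j → SameSubset p (suc r) (Gs i) (Gs j) → i ≡ j)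
  (Gs-surjective : ∀ H → IsSubgroup p (suc r) H → HasIndexP p (suc r) H → ∃ λ i → SameSubset p (suc r) H (Gs i))
  where

  open Vectors p
  open Counting p
  open Hyperplanes p p-prime

  Gs-subgroup : ∀ i → IsSubgroup p (suc r) (Gs i)
  Gs-subgroup i = proj₁ (Gs-index-p i)

  count-Gs : ∀ i → count (suc r) (Gs i) ≡ p ^ r
  count-Gs i = count-index-p (Gs-subgroup i) (proj₂ (Gs-index-p i))

  ψ : Fin N → V (suc r)
  ψ i = proj₁ (index-p⇒hyperplane (Gs-subgroup i) (proj₂ (Gs-index-p i)))

  ψ∈ℙ : ∀ i → ψ i ∈ ℙ (suc r)
  ψ∈ℙ i = proj₁ (proj₂ (index-p⇒hyperplane (Gs-subgroup i) (proj₂ (Gs-index-p i))))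

  Gs≗ker-ψ : ∀ i → SameSubset p (suc r) (Gs i) (ker (ψ i))
  Gs≗ker-ψ i = proj₂ (proj₂ (index-p⇒hyperplane (Gs-subgroup i) (proj₂ (Gs-index-p i))))

  ψ-enumerates-ℙ : map ψ (allFin N) ↭ ℙ (suc r)
  ψ-enumerates-ℙ = unique∧same-elements⇒↭ (Unique.map⁺ ψ-injective (Unique.allFin⁺ N)) (ℙ-unique (suc r)) ⊆ℙ ℙ⊆
    where
    ψ-injective : ∀ {i j} → ψ i ≡ ψ j → i ≡ j
    ψ-injective {i} {j} ψi≡ψj =
      Gs-injective i j (λ τ → ≡.trans (Gs≗ker-ψ i τ)
                                      (≡.trans (≡.cong (λ a → ker a τ) ψi≡ψj) (≡.sym (Gs≗ker-ψ j τ))))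
    ⊆ℙ : ∀ {a} → a ∈ map ψ (allFin N) → a ∈ ℙ (suc r)
    ⊆ℙ a∈ with ∈-map⁻ ψ a∈
    ... | i , _ , ≡.refl = ψ∈ℙ i
    ℙ⊆ : ∀ {a} → a ∈ ℙ (suc r) → a ∈ map ψ (allFin N)
    ℙ⊆ {a} a∈ℙ
      with Gs-surjective (ker a) (ker-subgroup a) (≡.cong (p *_) (≡.trans (card≡count (suc r) (ker a)) (count-ker a∈ℙ)))
    ... | j , ker-a≗Gs-j = ≡.subst (_∈ map ψ (allFin N))
      (ker⊆ker⇒≡ (ψ∈ℙ j) a∈ℙ (⊆-intro λ {τ} τ∈ → ≡.trans (≡.trans (ker-a≗Gs-j τ) (Gs≗ker-ψ j τ)) τ∈))
      (∈-map⁺ ψ (∈-allFin j))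

  Gs-distinct : ∀ {i j} → i ≢ j → ∃ λ τ → Gs i τ ≡ true × Gs j τ ≡ false
  Gs-distinct {i} {j} i≢j with ⊆-or-witness (Gs i) (Gs j)
  ... | inj₂ witness = witness
  ... | inj₁ Gs-i⊆Gs-j = contradiction
    (Gs-injective i j (⊆-antisym Gs-i⊆Gs-j
      (⊆∧count≤⇒⊇ Gs-i⊆Gs-j (≤-reflexive (≡.trans (count-Gs j) (≡.sym (count-Gs i)))))))
    i≢j

module Decomposition {c ℓ : Level} (p : ℕ) {{_ : NonZero p}} (p-prime : Prime p) (r : ℕ)
  (M : GModule p (suc r) c ℓ) (n : ℕ) (M-order : HasOrder p (suc r) M n) (n⊥p : Coprime n p)
  (inv : ℕ → GModule.Carrier M → GModule.Carrier M) (inv-spec : IsInverseOfMult p (suc r) M n inv)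
  (N : ℕ) (Gs : Fin N → Subset p (suc r))
  (Gs-index-p : ∀ i → IsSubgroup p (suc r) (Gs i) × HasIndexP p (suc r) (Gs i))
  (Gs-injective : ∀ i j → SameSubset p (suc r) (Gs i) (Gs j) → i ≡ j)
  (Gs-surjective : ∀ H → IsSubgroup p (suc r) H → HasIndexP p (suc r) H → ∃ λ i → SameSubset p (suc r) H (Gs i))
  where

  open Vectors p
  open Counting p
  open Hyperplanes p p-prime
  open IndexPSubgroups p p-prime r N Gs Gs-index-p Gs-injective Gs-surjective
  open GModule M
  open AbelianGroupProperties grp using (⁻¹-anti-homo-∙; \\-leftDividesˡ)
  open ModuleTheory p (suc r) M
  open Averaging inv inv-spec n⊥p
  open import Relation.Binary.Reasoning.Setoid setoid

  q : ℕ
  q = p ^ r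

  open Division inv inv-spec {q} (coprime-∣^ n⊥p (suc r) (divides p ≡.refl))

  δ₀-sum : ∀ m → ∑[ τ ∈ allG p (suc r) ] δ₀ τ q · act τ m ≈ q · m
  δ₀-sum m = trans (∑-cong (allG p (suc r)) at-origin) (∑-δ _≟V_ (allG-unique (suc r)) (∈-allG (0V (suc r))) (q · m))
    where
    at-origin : ∀ τ → δ₀ τ q · act τ m ≈ (if does (τ ≟V 0V (suc r)) then q · m else ε)
    at-origin τ with τ ≟V 0V (suc r)
    ... | yes ≡.refl = ·-congʳ q (act-0 m)
    ... | no  _      = refl

  ∑-Nm-hyperplanes : ∀ m → ∑[ a ∈ ℙ (suc r) ] Nm (ker a) m ≈ #ℙ r · Nm (whole p (suc r)) m ∙ q · m
  ∑-Nm-hyperplanes m = begin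
    ∑[ a ∈ ℙ (suc r) ] ∑[ τ ∈ allG p (suc r) ] χ (ker a τ) · act τ m
      ≈⟨ ∑-comm (ℙ (suc r)) (allG p (suc r)) _ ⟩
    ∑[ τ ∈ allG p (suc r) ] ∑[ a ∈ ℙ (suc r) ] χ (ker a τ) · act τ m
      ≈⟨ ∑-cong (allG p (suc r)) (λ τ → ∑-· (ℙ (suc r)) (λ a → χ (ker a τ)) (act τ m)) ⟩
    ∑[ τ ∈ allG p (suc r) ] (∑ℕ[ a ∈ ℙ (suc r) ] χ (ker a τ)) · act τ m
      ≈⟨ ∑-cong (allG p (suc r)) (λ τ → reflexive (≡.cong (_· act τ m) (#hyperplanes∋ r τ))) ⟩
    ∑[ τ ∈ allG p (suc r) ] (#ℙ r + δ₀ τ q) · act τ m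
      ≈⟨ ∑-cong (allG p (suc r)) (λ τ → ·-homo-+ (act τ m) (#ℙ r) (δ₀ τ q)) ⟩
    ∑[ τ ∈ allG p (suc r) ] #ℙ r · act τ m ∙ δ₀ τ q · act τ m
      ≈⟨ ∑-distrib-∙ (allG p (suc r)) _ _ ⟩
    (∑[ τ ∈ allG p (suc r) ] #ℙ r · act τ m) ∙ (∑[ τ ∈ allG p (suc r) ] δ₀ τ q · act τ m)
      ≈⟨ ∙-cong (∑-cong (allG p (suc r)) (λ τ → ·-congʳ (#ℙ r) (sym (identityʳ (act τ m))))) (δ₀-sum m) ⟩
    (∑[ τ ∈ allG p (suc r) ] #ℙ r · (1 · act τ m)) ∙ q · m
      ≈⟨ ∙-congʳ (·-∑ (#ℙ r) (allG p (suc r)) (λ τ → 1 · act τ m)) ⟨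
    #ℙ r · Nm (whole p (suc r)) m ∙ q · m ∎

  W : Carrier → Carrier
  W m = inv q (#ℙ r · Nm (whole p (suc r)) m)

  W-fixed : ∀ m → Fixed p (suc r) M (whole p (suc r)) (W m)
  W-fixed m σ _ = trans (inv-act σ _) (inv-cong (trans (act-· σ (#ℙ r) _)
                        (·-congʳ (#ℙ r) (Nm-fixed (whole-subgroup (suc r)) m σ ≡.refl))))

  ∑ε≈W∙m : ∀ m → sumFin p (suc r) M N (λ i → ε[ Gs i ] m) ≈ W m ∙ m
  ∑ε≈W∙m m = begin
    sumFin p (suc r) M N (λ i → ε[ Gs i ] m)      ≈⟨ sumFin≈∑ N _ ⟩
    ∑[ i ∈ allFin N ] ε[ Gs i ] m                  ≈⟨ ∑-cong (allFin N) (λ i → reflexive (epsH-SameSubset {inv} (Gs≗ker-ψ i) m)) ⟩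
    ∑[ i ∈ allFin N ] ε[ ker (ψ i) ] m             ≡⟨ ∑-map (allFin N) ψ (λ a → ε[ ker a ] m) ⟨
    ∑[ a ∈ map ψ (allFin N) ] ε[ ker a ] m         ≈⟨ ∑-↭ (λ a → ε[ ker a ] m) ψ-enumerates-ℙ ⟩
    ∑[ a ∈ ℙ (suc r) ] ε[ ker a ] m                ≈⟨ ∑-cong-∈ (ℙ (suc r)) ε-hyperplane ⟩
    ∑[ a ∈ ℙ (suc r) ] inv q (Nm (ker a) m)        ≈⟨ inv-∑ (ℙ (suc r)) (λ a → Nm (ker a) m) ⟨
    inv q (∑[ a ∈ ℙ (suc r) ] Nm (ker a) m)        ≈⟨ inv-cong (∑-Nm-hyperplanes m) ⟩
    inv q (#ℙ r · Nm (whole p (suc r)) m ∙ q · m)  ≈⟨ inv-∙ _ (q · m) ⟩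
    W m ∙ inv q (q · m)                            ≈⟨ ∙-congˡ (inv-· m) ⟩
    W m ∙ m                                        ∎
    where
    ε-hyperplane : ∀ {a} → a ∈ ℙ (suc r) → ε[ ker a ] m ≈ inv q (Nm (ker a) m)
    ε-hyperplane {a} a∈ℙ = trans (ε≈inv-Nm (ker-subgroup a) m)
      (reflexive (≡.cong (λ k → inv k (Nm (ker a) m)) (≡.trans (card≡count (suc r) (ker a)) (count-ker a∈ℙ))))

  m-∑ε-fixed : ∀ m → Fixed p (suc r) M (whole p (suc r)) (_-M_ p (suc r) M m (sumFin p (suc r) M N (λ i → ε[ Gs i ] m)))
  m-∑ε-fixed m = Fixed-resp (whole p (suc r)) m-∑ε≈W⁻¹ (Fixed-⁻¹ (whole p (suc r)) (W-fixed m))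
    where
    m-∑ε≈W⁻¹ : m ∙ sumFin p (suc r) M N (λ i → ε[ Gs i ] m) ⁻¹ ≈ W m ⁻¹
    m-∑ε≈W⁻¹ = begin
      m ∙ sumFin p (suc r) M N (λ i → ε[ Gs i ] m) ⁻¹  ≈⟨ ∙-congˡ (⁻¹-cong (∑ε≈W∙m m)) ⟩
      m ∙ (W m ∙ m) ⁻¹                                  ≈⟨ ∙-congˡ (⁻¹-anti-homo-∙ (W m) m) ⟩
      m ∙ (m ⁻¹ ∙ W m ⁻¹)                               ≈⟨ \\-leftDividesˡ m (W m ⁻¹) ⟩
      W m ⁻¹                                            ∎

  _≟M_ : Decidable _≈_
  x ≟M y with Bijection.strictlySurjective M-order x | Bijection.strictlySurjective M-order y
  ... | i , i↦x | j , j↦y with i ≟F j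
  ... | yes ≡.refl = yes (trans (sym i↦x) j↦y)
  ... | no  i≢j    = no (λ x≈y → i≢j (Bijection.injective M-order (trans i↦x (trans x≈y (sym j↦y)))))

  stabiliser : Carrier → Subset p (suc r)
  stabiliser y g = does (act g y ≟M y)

  stabiliser-subgroup : ∀ y → IsSubgroup p (suc r) (stabiliser y)
  stabiliser-subgroup y =
    dec-true (act (0V (suc r)) y ≟M y) (act-0 y) ,
    (λ g h g∈ h∈ → dec-true (act (g +V h) y ≟M y)
      (trans (act-+ g h y) (trans (act-cong g (stabilises h h∈)) (stabilises g g∈)))) ,
    (λ g g∈ → dec-true (act (-V g) y ≟M y) (begin
      act (-V g) y           ≈⟨ act-cong (-V g) (stabilises g g∈) ⟨
      act (-V g) (act g y)   ≈⟨ act-+ (-V g) g y ⟨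
      act (-V g +V g) y      ≡⟨ ≡.cong (λ σ → act σ y) (𝕍.inverseˡ g) ⟩
      act (0V (suc r)) y     ≈⟨ act-0 y ⟩
      y                      ∎))
    where
    stabilises : ∀ g → stabiliser y g ≡ true → act g y ≈ y
    stabilises g = dec-true⁻¹ (act g y ≟M y)

  ε-fixed-everywhere : ∀ {i j m} → i ≢ j → Fixed p (suc r) M (Gs i) m → Fixed p (suc r) M (whole p (suc r)) (ε[ Gs j ] m)
  ε-fixed-everywhere {i} {j} {m} i≢j m-fixed σ _ =
    let τ , τ∈Gs-i , τ∉Gs-j = Gs-distinct i≢j in
    dec-true⁻¹ (act σ y ≟M y)
      (index-p-maximal p-prime (proj₂ (Gs-index-p j)) (stabiliser-subgroup y)
        (⊆-intro λ {g} g∈Gs-j → dec-true (act g y ≟M y) (ε-fixed (Gs-subgroup j) m g g∈Gs-j))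
        (dec-true (act τ y ≟M y) (trans (ε-act (Gs-subgroup j) τ m) (ε-cong (Gs-subgroup j) (m-fixed τ τ∈Gs-i))))
        τ∉Gs-j σ)
    where
    y = ε[ Gs j ] m

  ε-∑-fixed : ∀ (ms : Fin N → Carrier) → (∀ i → Fixed p (suc r) M (Gs i) (ms i)) → ∀ j →
              Fixed p (suc r) M (whole p (suc r)) (_-M_ p (suc r) M (ε[ Gs j ] (sumFin p (suc r) M N ms)) (ms j))
  ε-∑-fixed ms ms-fixed j = Fixed-resp (whole p (suc r)) split (Fixed-∑ (whole p (suc r)) (allFin N) term term-fixed)
    where
    term : Fin N → Carrier
    term i = ε[ Gs j ] (ms i) ∙ (if does (i ≟F j) then ms j ⁻¹ else ε)
    term-fixed : ∀ i → Fixed p (suc r) M (whole p (suc r)) (term i)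
    term-fixed i with i ≟F j
    ... | yes ≡.refl = Fixed-resp (whole p (suc r))
                         (trans (∙-congʳ (ε-retract (Gs-subgroup j) (ms-fixed j))) (inverseʳ (ms j)))
                         (Fixed-ε (whole p (suc r)))
    ... | no  i≢j    = Fixed-resp (whole p (suc r)) (identityʳ _) (ε-fixed-everywhere i≢j (ms-fixed i))
    split : ε[ Gs j ] (sumFin p (suc r) M N ms) ∙ ms j ⁻¹ ≈ ∑ (allFin N) term
    split = begin
      ε[ Gs j ] (sumFin p (suc r) M N ms) ∙ ms j ⁻¹
        ≈⟨ ∙-congʳ (ε-cong (Gs-subgroup j) (sumFin≈∑ N ms)) ⟩
      ε[ Gs j ] (∑ (allFin N) ms) ∙ ms j ⁻¹
        ≈⟨ ∙-cong (ε-∑ (Gs-subgroup j) (allFin N) ms) (sym (∑-δ _≟F_ (Unique.allFin⁺ N) (∈-allFin j) (ms j ⁻¹))) ⟩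
      (∑[ i ∈ allFin N ] ε[ Gs j ] (ms i)) ∙ (∑[ i ∈ allFin N ] (if does (i ≟F j) then ms j ⁻¹ else ε))
        ≈⟨ ∑-distrib-∙ (allFin N) _ _ ⟨
      ∑ (allFin N) term ∎

G₀-fixes-everything : ∀ {c ℓ} p {{_ : NonZero p}} (M : GModule p 0 c ℓ) x → Fixed p 0 M (whole p 0) x
G₀-fixes-everything p M x [] _ = GModule.act-0 M x

lemma15 : ∀ {c ℓ : Level} (p : ℕ) {{nz : NonZero p}} → Prime p → (r : ℕ)
    → (M : GModule p r c ℓ) → (n : ℕ) → HasOrder p r M n → Coprime n p
    → (inv : ℕ → GModule.Carrier M → GModule.Carrier M) → IsInverseOfMult p r M n inv
    → (N : ℕ) → (Gs : Fin N → Subset p r)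
    → (∀ i → IsSubgroup p r (Gs i) × HasIndexP p r (Gs i))
    → (∀ i j → SameSubset p r (Gs i) (Gs j) → i ≡ j)
    → (∀ H → IsSubgroup p r H → HasIndexP p r H → ∃ λ i → SameSubset p r H (Gs i))
    → (∀ H → IsSubgroup p r H
         → (∀ m → Fixed p r M H (epsH p r M inv H m))
           × (∀ x → Fixed p r M H x → ∃ λ m → GModule._≈_ M (epsH p r M inv H m) x))
      × (∀ i m → Fixed p r M (whole p r) m → Fixed p r M (whole p r) (epsH p r M inv (Gs i) m))
      × (∀ m → Fixed p r M (whole p r)
           (_-M_ p r M m (sumFin p r M N (λ i → epsH p r M inv (Gs i) m))))
      × (∀ (ms : Fin N → GModule.Carrier M) → (∀ i → Fixed p r M (Gs i) (ms i))
           → ∀ j → Fixed p r M (whole p r)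
                     (_-M_ p r M (epsH p r M inv (Gs j) (sumFin p r M N ms)) (ms j)))
lemma15 p p-prime zero M n _ n⊥p inv inv-spec N Gs Gs-index-p _ _ =
  ε-image , (λ i m → ε-preserves-G-fixed (proj₁ (Gs-index-p i))) ,
  (λ _ → G₀-fixes-everything p M _) , (λ _ _ _ → G₀-fixes-everything p M _)
  where
  open ModuleTheory p zero M
  open Averaging inv inv-spec n⊥p
lemma15 p p-prime (suc r) M n M-order n⊥p inv inv-spec N Gs Gs-index-p Gs-injective Gs-surjective =
  ε-image , (λ i m → ε-preserves-G-fixed (proj₁ (Gs-index-p i))) , m-∑ε-fixed , ε-∑-fixed
  where
  open ModuleTheory p (suc r) M
  open Averaging inv inv-spec n⊥p
  open Decomposition p p-prime r M n M-order n⊥p inv inv-spec N Gs Gs-index-p Gs-injective Gs-surjective
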